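{- Let $\pi$ be a pattern (a nonempty finite word over $\{U,D,L\}$) with amplitude $r_\pi$. Let $\mathcal{A}$ be the set $\mathcal{SD}^{h_\pi,\geqslant}$ of skew Dyck paths defined below, let $u$ be the generating function (by semilength, variable $x$) of paths $P\in\mathcal{A}$ with $h_\pi(P)=r_\pi$ and $v$ that of paths $P\in\mathcal{A}$ with $h_\pi(P)=0$. Then the generating function of $\mathcal{A}$ by semilength is $$A(x)=\frac{uvx^2+v^2x^2-x^2u-xu-x^2+1-\sqrt{\Delta}}{2x^2(1+v+u)},$$ with $\Delta=u^2v^2x^4+2uv^3x^4+v^4x^4+2u^2vx^4+6uv^2x^4+4v^3x^4-2u^2vx^3+u^2x^4-2uv^2x^3+6uvx^4+6v^2x^4-2x^3u^2-4uvx^3+2ux^4+4vx^4-3u^2x^2-6uvx^2-2ux^3-2v^2x^2+x^4-6x^2u-4vx^2-2xu-2x^2+1$.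
   Context: A skew Dyck path is a lattice path in the quarter plane starting at $(0,0)$, ending on the $x$-axis and never going below it, with steps $U=(1,1)$, $D=(1,-1)$ and $L=(-1,-1)$, such that left and up steps never overlap (no $UL$ or $LU$ factors). A pattern is a factor of consecutive steps; the height of an occurrence is the maximal ordinate reached by its points; $h_\pi(P)$ is the maximal height of an occurrence of $\pi$ in $P$ ($0$ if $\pi$ does not occur). The amplitude $r_\pi$ is the height of $\pi$ viewed as a path in the quarter plane whose lowest point touches the $x$-axis. The set $\mathcal{SD}^{h_\pi,\geqslant}$ consists of the empty path together with all skew Dyck paths $P$ whose first return decomposition is either $P=U\alpha D\beta$ with $\alpha,\beta\in\mathcal{SD}^{h_\pi,\geqslant}$ and $h_\pi(U\alpha D)\geqslant h_\pi(\beta)$ (computed on $U\alpha D$ alone), or $P=U\alpha L$ with $\alpha\in\mathcal{SD}^{h_\pi,\geqslant}$ nonempty. -}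

module Defs where

open import Data.Nat using (ℕ; zero; suc; _∸_)
open import Data.Integer using (ℤ; +_; 0ℤ; 1ℤ; _+_; _-_; _*_; -_; _⊔_; _⊓_; _≤_)
open import Data.Bool using (Bool; true; false; if_then_else_; _∧_)
open import Data.List using (List; []; _∷_; _++_; length)
open import Data.List.Membership.Propositional using (_∈_)
open import Data.List.Relation.Unary.Unique.Propositional using (Unique)
open import Data.Product using (Σ; _×_)
open import Relation.Binary.PropositionalEquality using (_≡_; _≢_)
open import Function.Bundles using (_⇔_)

-- Steps U = (1,1), D = (1,-1), L = (-1,-1)

data Step : Set where
  U D L : Step

dy : Step → ℤ
dy U = 1ℤ
dy D = - 1ℤ
dy L = - 1ℤ

_==ₛ_ : Step → Step → Bool
U ==ₛ U = true
D ==ₛ D = true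
L ==ₛ L = true
_ ==ₛ _ = false

isPrefix : List Step → List Step → Bool
isPrefix [] _ = true
isPrefix (_ ∷ _) [] = false
isPrefix (a ∷ p) (b ∷ w) = (a ==ₛ b) ∧ isPrefix p w

maxPS : List Step → ℤ
maxPS [] = 0ℤ
maxPS (s ∷ w) = 0ℤ ⊔ (dy s + maxPS w)

minPS : List Step → ℤ
minPS [] = 0ℤ
minPS (s ∷ w) = 0ℤ ⊓ (dy s + minPS w)

-- amplitude r_π : height of π translated so that its lowest point is on the x-axis
amplitude : List Step → ℤ
amplitude π = maxPS π - minPS π

occ : List Step → ℤ → List Step → ℤ
occ π c w = if isPrefix π w then c + maxPS π else 0ℤ

hAux : List Step → ℤ → List Step → ℤ
hAux π c [] = occ π c []
hAux π c (s ∷ w) = occ π c (s ∷ w) ⊔ hAux π (c + dy s) w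

h : List Step → List Step → ℤ
h π P = hAux π 0ℤ P

-- The class SD^{h_π,≥}, defined by its first return decomposition

data InA (π : List Step) : List Step → Set where
  nil : InA π []
  ud  : ∀ {α β} → InA π α → InA π β →
        h π β ≤ h π (U ∷ α ++ D ∷ []) →
        InA π (U ∷ α ++ D ∷ β)
  ul  : ∀ {α} → InA π α → α ≢ [] → InA π (U ∷ α ++ L ∷ [])

semilength : List Step → ℕ
semilength [] = 0
semilength (U ∷ w) = suc (semilength w)
semilength (_ ∷ w) = semilength w

Count : (List Step → Set) → ℕ → ℕ → Set
Count P n c = Σ (List (List Step)) λ ws →
  Unique ws × (∀ w → (w ∈ ws) ⇔ (P w × semilength w ≡ n)) × length ws ≡ c

Series : Set
Series = ℕ → ℤ

cst : ℤ → Series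
cst a zero = a
cst a (suc n) = 0ℤ

X : Series
X 1 = 1ℤ
X _ = 0ℤ

_⊕_ : Series → Series → Series
(f ⊕ g) n = f n + g n

_⊖_ : Series → Series → Series
(f ⊖ g) n = f n - g n

sumTo : (ℕ → ℤ) → ℕ → ℤ
sumTo t zero = t 0
sumTo t (suc n) = sumTo t n + t (suc n)

_⊛_ : Series → Series → Series
(f ⊛ g) n = sumTo (λ i → f i * g (n ∸ i)) n

infixl 7 _⊛_
infixl 6 _⊕_ _⊖_

_^ₛ_ : Series → ℕ → Series
f ^ₛ zero = cst 1ℤ
f ^ₛ suc k = f ⊛ (f ^ₛ k)

infixr 9 _^ₛ_

_·_ : ℤ → Series → Series
(a · f) n = a * f n

infixr 8 _·_

toS : (ℕ → ℕ) → Series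
toS a n = + (a n)

-- Let r be the amplitude of π and h the height of the highest occurrence of π. In a
-- path of A, h is 0 or at least r, and the paths with h = r + j + 1 are exactly the
-- U α L and U α D β with h α = r + j and h β ≤ r + j + 1 (first return decomposition).
-- Hence, if c j is 1 plus the generating function of the paths with h < r + j, then
-- c 0 = 1 + V, c 1 = 1 + V + U and c (j+2) - c (j+1) = x (c (j+1) - c j) c (j+2).
-- A polynomial identity turns this recurrence into the invariance of
-- G (c j) (c (j+1)) / c (j+1), where G a b = x² b A² - N a b A + K a b is quadratic
-- in A. As c j tends to 1 + A coefficientwise and G (1 + A) (1 + A) = 0, we get
-- G (1 + V) (1 + V + U) = 0, and solving this quadratic gives the closed form: with
-- S = N - 2x²(1 + V + U) A one has S² = Δ + 4x²(1 + U + V) G (1 + V) (1 + V + U) = Δ.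

module Submission where

open import Defs
open import Algebra.Bundles using (CommutativeRing)
open import Algebra.Structures using (IsCommutativeRing)
import Algebra.Solver.Ring
open import Algebra.Solver.Ring.AlmostCommutativeRing
  using (fromCommutativeRing; _-Raw-AlmostCommutative⟶_)
open import Data.Bool using (true; false; _∧_)
open import Data.Empty using (⊥; ⊥-elim)
open import Data.Fin using (Fin; zero; suc)
open import Data.List using (List; []; _∷_; _++_; length; map; filter; cartesianProductWith)
import Data.List.Properties as ListP
open import Data.List.Membership.Propositional using (_∈_)
open import Data.List.Membership.Propositional.Properties
  using (∈-++⁺ˡ; ∈-++⁺ʳ; ∈-++⁻; ∈-map⁺; ∈-map⁻; ∈-filter⁺; ∈-filter⁻; ∈-cartesianProductWith⁺; ∈-cartesianProductWith⁻)
open import Data.List.Membership.Propositional.Properties.WithK using (unique∧set⇒bag)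
open import Data.List.Relation.Binary.BagAndSetEquality using (∼bag⇒↭)
open import Data.List.Relation.Binary.Disjoint.Propositional using (Disjoint)
open import Data.List.Relation.Binary.Permutation.Propositional.Properties using (↭-length)
open import Data.List.Relation.Unary.All as All using (All; []; _∷_)
import Data.List.Relation.Unary.All.Properties as AllP
open import Data.List.Relation.Unary.AllPairs using ([]; _∷_)
open import Data.List.Relation.Unary.Any using (here; there)
open import Data.List.Relation.Unary.Unique.Propositional using (Unique)
import Data.List.Relation.Unary.Unique.Propositional.Properties as UniqueP
open import Data.Integer as ℤ
  using (ℤ; +_; 0ℤ; 1ℤ; _+_; _-_; _*_; -_; _⊔_; _⊓_; _≤_; _<_; +≤+; +<+; -≤+)
import Data.Integer.Properties as ℤP
open import Data.Integer.Solver using (module +-*-Solver)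
open import Data.Maybe using (Maybe; just; nothing)
open import Data.Nat as ℕ using (ℕ; zero; suc; _∸_; z≤n; s≤s)
import Data.Nat.Properties as ℕP
open import Data.Product using (Σ; ∃; _×_; _,_; proj₁; proj₂)
open import Data.Sum using (_⊎_; inj₁; inj₂; [_,_]′)
open import Data.Vec using (Vec; []; _∷_; lookup)
open import Function using (_∘_)
import Level
open import Function.Bundles using (_⇔_; mk⇔; Equivalence)
open import Relation.Binary.PropositionalEquality
  using (_≡_; _≢_; refl; sym; trans; cong; cong₂; subst; module ≡-Reasoning)
open import Relation.Nullary using (¬_; yes; no)
open import Relation.Unary using (Pred; Decidable)

-- Formal power series form a commutative ring

infix 4 _≈_
_≈_ : Series → Series → Set
f ≈ g = ∀ n → f n ≡ g n

⊝_ : Series → Series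
(⊝ f) n = - f n

0ₛ 1ₛ : Series
0ₛ _ = 0ℤ
1ₛ = cst 1ℤ

tail : Series → Series
tail f = f ∘ suc

sumTo-cong-≤ : ∀ {t s : ℕ → ℤ} n → (∀ i → i ℕ.≤ n → t i ≡ s i) → sumTo t n ≡ sumTo s n
sumTo-cong-≤ zero e = e 0 z≤n
sumTo-cong-≤ (suc n) e =
  cong₂ _+_ (sumTo-cong-≤ n (λ i i≤n → e i (ℕP.m≤n⇒m≤1+n i≤n))) (e (suc n) ℕP.≤-refl)

sumTo-cong : ∀ {t s : ℕ → ℤ} → (∀ i → t i ≡ s i) → ∀ n → sumTo t n ≡ sumTo s n
sumTo-cong e n = sumTo-cong-≤ n (λ i _ → e i)

sumTo-unfoldˡ : ∀ (t : ℕ → ℤ) n → sumTo t (suc n) ≡ t 0 + sumTo (t ∘ suc) n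
sumTo-unfoldˡ t zero = refl
sumTo-unfoldˡ t (suc n) =
  trans (cong (_+ t (suc (suc n))) (sumTo-unfoldˡ t n)) (ℤP.+-assoc (t 0) _ _)

sumTo-+ : ∀ (t s : ℕ → ℤ) n → sumTo (λ i → t i + s i) n ≡ sumTo t n + sumTo s n
sumTo-+ t s zero = refl
sumTo-+ t s (suc n) rewrite sumTo-+ t s n =
  solve 4 (λ a b c d → (a :+ b) :+ (c :+ d) := (a :+ c) :+ (b :+ d)) refl
    (sumTo t n) (sumTo s n) (t (suc n)) (s (suc n))
  where open +-*-Solver

sumTo-*ˡ : ∀ c (t : ℕ → ℤ) n → sumTo (λ i → c * t i) n ≡ c * sumTo t n
sumTo-*ˡ c t zero = refl
sumTo-*ˡ c t (suc n) rewrite sumTo-*ˡ c t n = sym (ℤP.*-distribˡ-+ c (sumTo t n) (t (suc n)))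

sumTo-zero : ∀ (t : ℕ → ℤ) → (∀ i → t i ≡ 0ℤ) → ∀ n → sumTo t n ≡ 0ℤ
sumTo-zero t z zero = z 0
sumTo-zero t z (suc n) rewrite sumTo-zero t z n | z (suc n) = refl

sumTo-last : ∀ (t : ℕ → ℤ) n → (∀ i → i ℕ.< n → t i ≡ 0ℤ) → sumTo t n ≡ t n
sumTo-last t zero _ = refl
sumTo-last t (suc n) z = begin
  sumTo t n + t (suc n) ≡⟨ cong (_+ t (suc n)) (trans (sumTo-last t n (λ i i<n → z i (ℕP.m<n⇒m<1+n i<n))) (z n ℕP.≤-refl)) ⟩
  0ℤ + t (suc n)        ≡⟨ ℤP.+-identityˡ _ ⟩
  t (suc n)             ∎
  where open ≡-Reasoning

sumTo-reverse : ∀ (t : ℕ → ℤ) n → sumTo t n ≡ sumTo (λ i → t (n ∸ i)) n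
sumTo-reverse t zero = refl
sumTo-reverse t (suc n) = begin
  sumTo t (suc n)                          ≡⟨ sumTo-unfoldˡ t n ⟩
  t 0 + sumTo (t ∘ suc) n                  ≡⟨ cong (λ z → t 0 + z) (sumTo-reverse (t ∘ suc) n) ⟩
  t 0 + sumTo (λ i → t (suc (n ∸ i))) n    ≡⟨ ℤP.+-comm (t 0) _ ⟩
  sumTo (λ i → t (suc (n ∸ i))) n + t 0    ≡⟨ cong₂ _+_ (sumTo-cong-≤ n (λ i i≤n → cong t (sym (ℕP.+-∸-assoc 1 i≤n))))
                                                        (cong t (sym (ℕP.n∸n≡0 n))) ⟩
  sumTo (λ i → t (suc n ∸ i)) (suc n)      ∎
  where open ≡-Reasoning

⊛-suc : ∀ f g n → (f ⊛ g) (suc n) ≡ f 0 * g (suc n) + (tail f ⊛ g) n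
⊛-suc f g n = sumTo-unfoldˡ (λ i → f i * g (suc n ∸ i)) n

⊛-cong : ∀ {f f′ g g′} → f ≈ f′ → g ≈ g′ → f ⊛ g ≈ f′ ⊛ g′
⊛-cong ef eg n = sumTo-cong (λ i → cong₂ _*_ (ef i) (eg (n ∸ i))) n

⊛-comm : ∀ f g → f ⊛ g ≈ g ⊛ f
⊛-comm f g n = begin
  sumTo (λ i → f i * g (n ∸ i)) n              ≡⟨ sumTo-reverse _ n ⟩
  sumTo (λ i → f (n ∸ i) * g (n ∸ (n ∸ i))) n  ≡⟨ sumTo-cong-≤ n swap ⟩
  sumTo (λ i → g i * f (n ∸ i)) n              ∎
  where
  open ≡-Reasoning
  swap : ∀ i → i ℕ.≤ n → f (n ∸ i) * g (n ∸ (n ∸ i)) ≡ g i * f (n ∸ i)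
  swap i i≤n = trans (ℤP.*-comm (f (n ∸ i)) _) (cong (λ k → g k * f (n ∸ i)) (ℕP.m∸[m∸n]≡n i≤n))

⊛-distribˡ-⊕ : ∀ f g h → f ⊛ (g ⊕ h) ≈ f ⊛ g ⊕ f ⊛ h
⊛-distribˡ-⊕ f g h n =
  trans (sumTo-cong (λ i → ℤP.*-distribˡ-+ (f i) (g (n ∸ i)) (h (n ∸ i))) n) (sumTo-+ _ _ n)

⊛-distribʳ-⊕ : ∀ f g h → (g ⊕ h) ⊛ f ≈ g ⊛ f ⊕ h ⊛ f
⊛-distribʳ-⊕ f g h n =
  trans (sumTo-cong (λ i → ℤP.*-distribʳ-+ (f (n ∸ i)) (g i) (h i)) n) (sumTo-+ _ _ n)

·-⊛ : ∀ c f g → (c · f) ⊛ g ≈ c · (f ⊛ g)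
·-⊛ c f g n = trans (sumTo-cong (λ i → ℤP.*-assoc c (f i) (g (n ∸ i))) n) (sumTo-*ˡ c _ n)

⊛-assoc : ∀ f g h → (f ⊛ g) ⊛ h ≈ f ⊛ (g ⊛ h)
⊛-assoc f g h zero = ℤP.*-assoc (f 0) (g 0) (h 0)
⊛-assoc f g h (suc n) = begin
  ((f ⊛ g) ⊛ h) (suc n)
    ≡⟨ ⊛-suc (f ⊛ g) h n ⟩
  f₀g₀ * h (suc n) + (tail (f ⊛ g) ⊛ h) n
    ≡⟨ cong (λ z → f₀g₀ * h (suc n) + z) (⊛-cong {g = h} {g′ = h} (⊛-suc f g) (λ _ → refl) n) ⟩
  f₀g₀ * h (suc n) + ((f 0 · tail g ⊕ tail f ⊛ g) ⊛ h) n
    ≡⟨ cong (λ z → f₀g₀ * h (suc n) + z) (⊛-distribʳ-⊕ h (f 0 · tail g) (tail f ⊛ g) n) ⟩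
  f₀g₀ * h (suc n) + (((f 0 · tail g) ⊛ h) n + ((tail f ⊛ g) ⊛ h) n)
    ≡⟨ cong₂ (λ a b → f₀g₀ * h (suc n) + (a + b)) (·-⊛ (f 0) (tail g) h n) (⊛-assoc (tail f) g h n) ⟩
  f₀g₀ * h (suc n) + (f 0 * (tail g ⊛ h) n + (tail f ⊛ (g ⊛ h)) n)
    ≡⟨ solve 5 (λ a b c d e → (a :* b) :* c :+ (a :* d :+ e) := a :* (b :* c :+ d) :+ e) refl
         (f 0) (g 0) (h (suc n)) ((tail g ⊛ h) n) ((tail f ⊛ (g ⊛ h)) n) ⟩
  f 0 * (g 0 * h (suc n) + (tail g ⊛ h) n) + (tail f ⊛ (g ⊛ h)) n
    ≡⟨ cong (λ z → f 0 * z + (tail f ⊛ (g ⊛ h)) n) (sym (⊛-suc g h n)) ⟩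
  f 0 * (g ⊛ h) (suc n) + (tail f ⊛ (g ⊛ h)) n
    ≡⟨ sym (⊛-suc f (g ⊛ h) n) ⟩
  (f ⊛ (g ⊛ h)) (suc n) ∎
  where
  open ≡-Reasoning
  open +-*-Solver
  f₀g₀ = f 0 * g 0

⊛-identityˡ : ∀ f → 1ₛ ⊛ f ≈ f
⊛-identityˡ f zero = ℤP.*-identityˡ (f 0)
⊛-identityˡ f (suc n) = begin
  (1ₛ ⊛ f) (suc n)                      ≡⟨ ⊛-suc 1ₛ f n ⟩
  1ℤ * f (suc n) + (tail 1ₛ ⊛ f) n      ≡⟨ cong₂ _+_ (ℤP.*-identityˡ (f (suc n))) (sumTo-zero _ (λ _ → refl) n) ⟩
  f (suc n) + 0ℤ                        ≡⟨ ℤP.+-identityʳ _ ⟩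
  f (suc n)                             ∎
  where open ≡-Reasoning

⊛-identityʳ : ∀ f → f ⊛ 1ₛ ≈ f
⊛-identityʳ f n = trans (⊛-comm f 1ₛ n) (⊛-identityˡ f n)

⊛-zeroʳ : ∀ f → f ⊛ 0ₛ ≈ 0ₛ
⊛-zeroʳ f = sumTo-zero _ (λ i → ℤP.*-zeroʳ (f i))

series-isCommutativeRing : IsCommutativeRing _≈_ _⊕_ _⊛_ ⊝_ 0ₛ 1ₛ
series-isCommutativeRing = record
  { isRing = record
    { +-isAbelianGroup = record
      { isGroup = record
        { isMonoid = record
          { isSemigroup = record
            { isMagma = record
              { isEquivalence = record
                { refl = λ _ → refl ; sym = λ e n → sym (e n) ; trans = λ e e′ n → trans (e n) (e′ n) }
              ; ∙-cong = λ e e′ n → cong₂ _+_ (e n) (e′ n) }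
            ; assoc = λ f g h n → ℤP.+-assoc (f n) (g n) (h n) }
          ; identity = (λ f n → ℤP.+-identityˡ (f n)) , (λ f n → ℤP.+-identityʳ (f n)) }
        ; inverse = (λ f n → ℤP.+-inverseˡ (f n)) , (λ f n → ℤP.+-inverseʳ (f n))
        ; ⁻¹-cong = λ e n → cong -_ (e n) }
      ; comm = λ f g n → ℤP.+-comm (f n) (g n) }
    ; *-cong = ⊛-cong
    ; *-assoc = ⊛-assoc
    ; *-identity = ⊛-identityˡ , ⊛-identityʳ
    ; distrib = ⊛-distribˡ-⊕ , ⊛-distribʳ-⊕ }
  ; *-comm = ⊛-comm }

series-commutativeRing : CommutativeRing _ _
series-commutativeRing = record { isCommutativeRing = series-isCommutativeRing }

cst-homomorphism : ℤ.+-*-rawRing -Raw-AlmostCommutative⟶ fromCommutativeRing series-commutativeRing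
cst-homomorphism = record
  { ⟦_⟧ = cst
  ; +-homo = λ { a b zero → refl ; a b (suc n) → refl }
  ; *-homo = λ { a b zero → refl ; a b (suc n) → cst-⊛-suc a b n }
  ; -‿homo = λ { a zero → refl ; a (suc n) → refl }
  ; 0-homo = λ { zero → refl ; (suc n) → refl }
  ; 1-homo = λ n → refl
  }
  where
  cst-⊛-suc : ∀ a b n → 0ℤ ≡ (cst a ⊛ cst b) (suc n)
  cst-⊛-suc a b n = sym (trans (⊛-suc (cst a) (cst b) n)
    (cong₂ _+_ (ℤP.*-zeroʳ a) (sumTo-zero _ (λ _ → refl) n)))

cst-≟ : ∀ a b → Maybe (cst a ≈ cst b)
cst-≟ a b with a ℤ.≟ b
... | yes refl = just (λ _ → refl)
... | no _ = nothing

module SeriesSolver = Algebra.Solver.Ring ℤ.+-*-rawRing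
  (fromCommutativeRing series-commutativeRing) cst-homomorphism cst-≟

cst-⊛ : ∀ z g → cst z ⊛ g ≈ z · g
cst-⊛ z g zero = refl
cst-⊛ z g (suc n) = begin
  (cst z ⊛ g) (suc n)                    ≡⟨ ⊛-suc (cst z) g n ⟩
  z * g (suc n) + (tail (cst z) ⊛ g) n   ≡⟨ cong (λ w → z * g (suc n) + w) (sumTo-zero _ (λ _ → refl) n) ⟩
  z * g (suc n) + 0ℤ                     ≡⟨ ℤP.+-identityʳ _ ⟩
  z * g (suc n)                          ∎
  where open ≡-Reasoning

⊛-distribˡ-⊖ : ∀ f g h → f ⊛ (g ⊖ h) ≈ f ⊛ g ⊖ f ⊛ h
⊛-distribˡ-⊖ f g h = prove (f ∷ g ∷ h ∷ []) (F :* (G :- H)) (F :* G :- F :* H) (λ _ → refl)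
  where
  open SeriesSolver
  F G H : Polynomial 3
  F = var zero
  G = var (suc zero)
  H = var (suc (suc zero))

⊖≈0ₛ⇒≈ : ∀ {f g} → f ⊖ g ≈ 0ₛ → f ≈ g
⊖≈0ₛ⇒≈ {f} {g} e n = begin
  f n                 ≡⟨ solve 2 (λ a b → a := (a :- b) :+ b) refl (f n) (g n) ⟩
  (f n - g n) + g n   ≡⟨ cong (_+ g n) (e n) ⟩
  0ℤ + g n            ≡⟨ ℤP.+-identityˡ (g n) ⟩
  g n                 ∎
  where
  open ≡-Reasoning
  open +-*-Solver

-- The statement uses the scalar multiplication _·_, unknown to the ring solver: its
-- expressions are reflected into Expr and translated to solver polynomials.

infixl 6 _‵⊕_ _‵⊖_
infixl 7 _‵⊛_
infixr 8 _‵·_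
infixr 9 _‵^_

data Expr (m : ℕ) : Set where
  ‵var : Fin m → Expr m
  ‵cst : ℤ → Expr m
  _‵⊕_ _‵⊖_ _‵⊛_ : Expr m → Expr m → Expr m
  _‵·_ : ℤ → Expr m → Expr m
  _‵^_ : Expr m → ℕ → Expr m

⟦_⟧ₑ : ∀ {m} → Expr m → Vec Series m → Series
⟦ ‵var i ⟧ₑ ρ = lookup ρ i
⟦ ‵cst z ⟧ₑ ρ = cst z
⟦ e ‵⊕ f ⟧ₑ ρ = ⟦ e ⟧ₑ ρ ⊕ ⟦ f ⟧ₑ ρ
⟦ e ‵⊖ f ⟧ₑ ρ = ⟦ e ⟧ₑ ρ ⊖ ⟦ f ⟧ₑ ρ
⟦ e ‵⊛ f ⟧ₑ ρ = ⟦ e ⟧ₑ ρ ⊛ ⟦ f ⟧ₑ ρ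
⟦ z ‵· e ⟧ₑ ρ = z · ⟦ e ⟧ₑ ρ
⟦ e ‵^ k ⟧ₑ ρ = ⟦ e ⟧ₑ ρ ^ₛ k

module _ where
  open SeriesSolver

  toPolynomial : ∀ {m} → Expr m → Polynomial m
  toPolynomial (‵var i) = var i
  toPolynomial (‵cst z) = con z
  toPolynomial (e ‵⊕ f) = toPolynomial e :+ toPolynomial f
  toPolynomial (e ‵⊖ f) = toPolynomial e :- toPolynomial f
  toPolynomial (e ‵⊛ f) = toPolynomial e :* toPolynomial f
  toPolynomial (z ‵· e) = con z :* toPolynomial e
  toPolynomial (e ‵^ k) = toPolynomial e :^ k

  ⟦⟧ₑ≈⟦toPolynomial⟧ : ∀ {m} (e : Expr m) ρ → ⟦ e ⟧ₑ ρ ≈ ⟦ toPolynomial e ⟧ ρ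
  ⟦⟧ₑ≈⟦toPolynomial⟧ (‵var i) ρ n = refl
  ⟦⟧ₑ≈⟦toPolynomial⟧ (‵cst z) ρ n = refl
  ⟦⟧ₑ≈⟦toPolynomial⟧ (e ‵⊕ f) ρ n = cong₂ _+_ (⟦⟧ₑ≈⟦toPolynomial⟧ e ρ n) (⟦⟧ₑ≈⟦toPolynomial⟧ f ρ n)
  ⟦⟧ₑ≈⟦toPolynomial⟧ (e ‵⊖ f) ρ n = cong₂ _-_ (⟦⟧ₑ≈⟦toPolynomial⟧ e ρ n) (⟦⟧ₑ≈⟦toPolynomial⟧ f ρ n)
  ⟦⟧ₑ≈⟦toPolynomial⟧ (e ‵⊛ f) ρ = ⊛-cong (⟦⟧ₑ≈⟦toPolynomial⟧ e ρ) (⟦⟧ₑ≈⟦toPolynomial⟧ f ρ)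
  ⟦⟧ₑ≈⟦toPolynomial⟧ (z ‵· e) ρ n =
    trans (cong (z *_) (⟦⟧ₑ≈⟦toPolynomial⟧ e ρ n)) (sym (cst-⊛ z (⟦ toPolynomial e ⟧ ρ) n))
  ⟦⟧ₑ≈⟦toPolynomial⟧ (e ‵^ zero) ρ n = refl
  ⟦⟧ₑ≈⟦toPolynomial⟧ (e ‵^ suc k) ρ = ⊛-cong (⟦⟧ₑ≈⟦toPolynomial⟧ e ρ) (⟦⟧ₑ≈⟦toPolynomial⟧ (e ‵^ k) ρ)

infix 4 _≈[_]_
_≈[_]_ : Series → ℕ → Series → Set
f ≈[ n ] g = ∀ m → m ℕ.≤ n → f m ≡ g m

⊛-cong-≈[] : ∀ {f f′ g g′ n} → f ≈[ n ] f′ → g ≈[ n ] g′ → f ⊛ g ≈[ n ] f′ ⊛ g′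
⊛-cong-≈[] ef eg m m≤n = sumTo-cong-≤ m (λ i i≤m →
  cong₂ _*_ (ef i (ℕP.≤-trans i≤m m≤n)) (eg (m ∸ i) (ℕP.≤-trans (ℕP.m∸n≤m m i) m≤n)))

module _ where
  open SeriesSolver

  ⟦⟧-cong-≈[] : ∀ {k} (p : Polynomial k) {ρ ρ′ : Vec Series k} {n} →
    (∀ i → lookup ρ i ≈[ n ] lookup ρ′ i) → ⟦ p ⟧ ρ ≈[ n ] ⟦ p ⟧ ρ′
  ⟦⟧-cong-≈[] (op [+] p q) e m m≤n = cong₂ _+_ (⟦⟧-cong-≈[] p e m m≤n) (⟦⟧-cong-≈[] q e m m≤n)
  ⟦⟧-cong-≈[] (op [*] p q) e = ⊛-cong-≈[] (⟦⟧-cong-≈[] p e) (⟦⟧-cong-≈[] q e)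
  ⟦⟧-cong-≈[] (con c) e m m≤n = refl
  ⟦⟧-cong-≈[] (var x) e = e x
  ⟦⟧-cong-≈[] (p :^ zero) e m m≤n = refl
  ⟦⟧-cong-≈[] (p :^ suc k) e = ⊛-cong-≈[] (⟦⟧-cong-≈[] p e) (⟦⟧-cong-≈[] (p :^ k) e)
  ⟦⟧-cong-≈[] (:- p) e m m≤n = cong -_ (⟦⟧-cong-≈[] p e m m≤n)

X⊛-suc : ∀ f n → (X ⊛ f) (suc n) ≡ f n
X⊛-suc f n = begin
  (X ⊛ f) (suc n)                   ≡⟨ ⊛-suc X f n ⟩
  0ℤ * f (suc n) + (tail X ⊛ f) n   ≡⟨ ℤP.+-identityˡ _ ⟩
  (tail X ⊛ f) n                    ≡⟨ ⊛-cong {g = f} {g′ = f} tail-X (λ _ → refl) n ⟩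
  (1ₛ ⊛ f) n                        ≡⟨ ⊛-identityˡ f n ⟩
  f n                               ∎
  where
  open ≡-Reasoning
  tail-X : tail X ≈ 1ₛ
  tail-X zero = refl
  tail-X (suc _) = refl

X⊛≈0ₛ⇒≈0ₛ : ∀ f → X ⊛ f ≈ 0ₛ → f ≈ 0ₛ
X⊛≈0ₛ⇒≈0ₛ f e n = trans (sym (X⊛-suc f n)) (e (suc n))

⊛-lowest-order : ∀ c f n → (∀ m → m ℕ.< n → f m ≡ 0ℤ) → (f ⊛ c) n ≡ f n * c 0
⊛-lowest-order c f n z = trans
  (sumTo-last (λ i → f i * c (n ∸ i)) n (λ i i<n → cong (_* c (n ∸ i)) (z i i<n)))
  (cong (λ k → f n * c k) (ℕP.n∸n≡0 n))

module _ (c : Series) (c₀≢0 : c 0 ≢ 0ℤ) where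

  ⊛-vanishing-order : ∀ f m → (∀ k → k ℕ.< m → f k ≡ 0ℤ) → (c ⊛ f) m ≡ 0ℤ → f m ≡ 0ℤ
  ⊛-vanishing-order f m z cf≡0
    with ℤP.i*j≡0⇒i≡0∨j≡0 (f m) (trans (sym (⊛-lowest-order c f m z)) (trans (sym (⊛-comm c f m)) cf≡0))
  ... | inj₁ fm≡0 = fm≡0
  ... | inj₂ c₀≡0 = ⊥-elim (c₀≢0 c₀≡0)

  ⊛≈[]0ₛ⇒≈[]0ₛ : ∀ f n → c ⊛ f ≈[ n ] 0ₛ → f ≈[ n ] 0ₛ
  ⊛≈[]0ₛ⇒≈[]0ₛ f zero e zero _ = ⊛-vanishing-order f 0 (λ _ ()) (e 0 z≤n)
  ⊛≈[]0ₛ⇒≈[]0ₛ f (suc n) e m m≤1+n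
    with ℕP.m≤n⇒m<n∨m≡n m≤1+n | ⊛≈[]0ₛ⇒≈[]0ₛ f n (λ k k≤n → e k (ℕP.m≤n⇒m≤1+n k≤n))
  ... | inj₁ m<1+n | f≈[n]0 = f≈[n]0 m (ℕP.≤-pred m<1+n)
  ... | inj₂ refl | f≈[n]0 = ⊛-vanishing-order f (suc n) (λ k k<1+n → f≈[n]0 k (ℕP.≤-pred k<1+n)) (e (suc n) ℕP.≤-refl)

  ⊛-cancelˡ : ∀ f g → c ⊛ f ≈ c ⊛ g → f ≈ g
  ⊛-cancelˡ f g e = ⊖≈0ₛ⇒≈ (λ n → ⊛≈[]0ₛ⇒≈[]0ₛ (f ⊖ g) n c⊛[f⊖g]≈0 n ℕP.≤-refl)
    where
    c⊛[f⊖g]≈0 : ∀ {n} → c ⊛ (f ⊖ g) ≈[ n ] 0ₛ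
    c⊛[f⊖g]≈0 m _ = begin
      (c ⊛ (f ⊖ g)) m              ≡⟨ ⊛-distribˡ-⊖ c f g m ⟩
      (c ⊛ f) m - (c ⊛ g) m        ≡⟨ cong (_- (c ⊛ g) m) (e m) ⟩
      (c ⊛ g) m - (c ⊛ g) m        ≡⟨ ℤP.+-inverseʳ ((c ⊛ g) m) ⟩
      0ℤ                           ∎
      where open ≡-Reasoning

-- The quadratic equation as the limit of a telescoping invariant

module _ where
  open SeriesSolver

  -- For a = 1 + V and b = 1 + V + U this is the equation of A, with discriminant Δ.
  quadraticₚ : ∀ {m} (a b x F : Polynomial m) → Polynomial m
  quadraticₚ a b x F = (x :^ 2) :* b :* (F :^ 2) :- N :* F :+ K
    where
    N = con 1ℤ :- x :* (b :- a) :- x :^ 2 :+ x :^ 2 :* (a :- con 1ℤ) :* (b :- con 1ℤ) :- x :^ 2 :* (b :- a)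
    K = (b :- con 1ℤ) :+ x :* (b :- a) :- x :^ 2 :* (a :- con 1ℤ) :* b

  quadratic : Series → Series → Series → Series
  quadratic a b F = ⟦ quadraticₚ (var zero) (var (suc zero)) (var (suc (suc zero))) (var (suc (suc (suc zero)))) ⟧
                      (a ∷ b ∷ X ∷ F ∷ [])

  quadratic-cong-≈[] : ∀ {a a′ b b′} F {n} → a ≈[ n ] a′ → b ≈[ n ] b′ → quadratic a b F ≈[ n ] quadratic a′ b′ F
  quadratic-cong-≈[] {a} {a′} {b} {b′} F a≈a′ b≈b′ =
    ⟦⟧-cong-≈[] (quadraticₚ (var zero) (var (suc zero)) (var (suc (suc zero))) (var (suc (suc (suc zero)))))
      {ρ = a ∷ b ∷ X ∷ F ∷ []} {ρ′ = a′ ∷ b′ ∷ X ∷ F ∷ []} agree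
    where
    agree : ∀ i → lookup (a ∷ b ∷ X ∷ F ∷ []) i ≈[ _ ] lookup (a′ ∷ b′ ∷ X ∷ F ∷ []) i
    agree zero = a≈a′
    agree (suc zero) = b≈b′
    agree (suc (suc zero)) _ _ = refl
    agree (suc (suc (suc zero))) _ _ = refl

  quadratic-cong : ∀ {a a′ b b′} F → a ≈ a′ → b ≈ b′ → quadratic a b F ≈ quadratic a′ b′ F
  quadratic-cong F a≈a′ b≈b′ n = quadratic-cong-≈[] F (λ m _ → a≈a′ m) (λ m _ → b≈b′ m) n ℕP.≤-refl

recurrence : Series → Series → Series → Series
recurrence a b c = (c ⊖ b) ⊖ X ⊛ (b ⊖ a) ⊛ c

module _ where
  open SeriesSolver

  quadratic-diagonal : ∀ F → quadratic (1ₛ ⊕ F) (1ₛ ⊕ F) F ≈ 0ₛ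
  quadratic-diagonal F n = trans (prove (F ∷ X ∷ []) (quadraticₚ (con 1ℤ :+ f) (con 1ℤ :+ f) x f) (con 0ℤ) (λ _ → refl) n) (cst0 n)
    where
    f x : Polynomial 2
    f = var zero
    x = var (suc zero)
    cst0 : cst 0ℤ ≈ 0ₛ
    cst0 zero = refl
    cst0 (suc _) = refl

  quadratic-shift : ∀ a b c F →
    X ⊛ (c ⊛ quadratic a b F ⊖ b ⊛ quadratic b c F) ≈ ⊝ ((X ⊕ X ^ₛ 2 ⊛ b) ⊛ (F ⊕ 1ₛ)) ⊛ recurrence a b c
  quadratic-shift a b c F = prove (a ∷ b ∷ c ∷ X ∷ F ∷ [])
    (x :* (C :* quadraticₚ A B x F′ :- B :* quadraticₚ B C x F′))
    (:- ((x :+ x :^ 2 :* B) :* (F′ :+ con 1ℤ)) :* ((C :- B) :- x :* (B :- A) :* C))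
    (λ _ → refl)
    where
    A B C x F′ : Polynomial 5
    A = var zero
    B = var (suc zero)
    C = var (suc (suc zero))
    x = var (suc (suc (suc zero)))
    F′ = var (suc (suc (suc (suc zero))))

Converges : (ℕ → Series) → Series → Set
Converges c f = ∀ n → Σ ℕ λ J → ∀ j → J ℕ.≤ j → c j ≈[ n ] f

-- By quadratic-shift, Q j / c (j+1) does not depend on j when the recurrence
-- holds; as Q j tends to quadratic (1+F) (1+F) F = 0, so does Q 0.
module _ (c : ℕ → Series) (F : Series)
         (c₀≢0 : ∀ j → c j 0 ≢ 0ℤ)
         (c-recurrence : ∀ j → recurrence (c j) (c (suc j)) (c (suc (suc j))) ≈ 0ₛ) where

  private
    Q : ℕ → Series
    Q j = quadratic (c j) (c (suc j)) F

    Q-step : ∀ j → c (suc (suc j)) ⊛ Q j ≈ c (suc j) ⊛ Q (suc j)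
    Q-step j = ⊖≈0ₛ⇒≈ (X⊛≈0ₛ⇒≈0ₛ _ (λ n → trans
      (quadratic-shift (c j) (c (suc j)) (c (suc (suc j))) F n)
      (trans (⊛-cong {f = factor} {f′ = factor} (λ _ → refl) (c-recurrence j) n) (⊛-zeroʳ factor n))))
      where factor = ⊝ ((X ⊕ X ^ₛ 2 ⊛ c (suc j)) ⊛ (F ⊕ 1ₛ))

    ⊛-swapˡ : ∀ f g h → f ⊛ (g ⊛ h) ≈ g ⊛ (f ⊛ h)
    ⊛-swapˡ f g h n = trans (sym (⊛-assoc f g h n))
      (trans (⊛-cong {g = h} {g′ = h} (⊛-comm f g) (λ _ → refl) n) (⊛-assoc g f h n))

    Q-telescope : ∀ j → c (suc j) ⊛ Q 0 ≈ c 1 ⊛ Q j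
    Q-telescope zero _ = refl
    Q-telescope (suc j) = ⊛-cancelˡ (c (suc j)) (c₀≢0 (suc j)) _ _ λ n → begin
      (c₁₊ⱼ ⊛ (c₂₊ⱼ ⊛ Q 0)) n  ≡⟨ ⊛-swapˡ c₁₊ⱼ c₂₊ⱼ (Q 0) n ⟩
      (c₂₊ⱼ ⊛ (c₁₊ⱼ ⊛ Q 0)) n  ≡⟨ ⊛-cong {f = c₂₊ⱼ} (λ _ → refl) (Q-telescope j) n ⟩
      (c₂₊ⱼ ⊛ (c 1 ⊛ Q j)) n   ≡⟨ ⊛-swapˡ c₂₊ⱼ (c 1) (Q j) n ⟩
      (c 1 ⊛ (c₂₊ⱼ ⊛ Q j)) n   ≡⟨ ⊛-cong {f = c 1} (λ _ → refl) (Q-step j) n ⟩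
      (c 1 ⊛ (c₁₊ⱼ ⊛ Q (suc j))) n ≡⟨ ⊛-swapˡ (c 1) c₁₊ⱼ (Q (suc j)) n ⟩
      (c₁₊ⱼ ⊛ (c 1 ⊛ Q (suc j))) n ∎
      where
      open ≡-Reasoning
      c₁₊ⱼ = c (suc j)
      c₂₊ⱼ = c (suc (suc j))

  quadratic-limit : Converges c (1ₛ ⊕ F) → quadratic (c 0) (c 1) F ≈ 0ₛ
  quadratic-limit c→1+F n = ⊛≈[]0ₛ⇒≈[]0ₛ (c (suc J)) (c₀≢0 (suc J)) (Q 0) n c[1+J]⊛Q₀≈0 n ℕP.≤-refl
    where
    J = proj₁ (c→1+F n)
    c≈1+F = proj₂ (c→1+F n)
    Q_J≈0 : Q J ≈[ n ] 0ₛ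
    Q_J≈0 m m≤n = trans (quadratic-cong-≈[] F (c≈1+F J ℕP.≤-refl) (c≈1+F (suc J) (ℕP.n≤1+n J)) m m≤n)
                        (quadratic-diagonal F m)
    c[1+J]⊛Q₀≈0 : c (suc J) ⊛ Q 0 ≈[ n ] 0ₛ
    c[1+J]⊛Q₀≈0 m m≤n = trans (Q-telescope J m)
      (trans (⊛-cong-≈[] {f = c 1} {f′ = c 1} (λ _ _ → refl) Q_J≈0 m m≤n) (⊛-zeroʳ (c 1) m))

-- Heights of pattern occurrences

ordinate : List Step → ℤ
ordinate [] = 0ℤ
ordinate (s ∷ w) = dy s + ordinate w

ordinate-++ : ∀ u w → ordinate (u ++ w) ≡ ordinate u + ordinate w
ordinate-++ [] w = sym (ℤP.+-identityˡ (ordinate w))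
ordinate-++ (s ∷ u) w rewrite ordinate-++ u w = sym (ℤP.+-assoc (dy s) (ordinate u) (ordinate w))

NonNeg : ℤ → List Step → Set
NonNeg c [] = 0ℤ ≤ c
NonNeg c (s ∷ w) = 0ℤ ≤ c × NonNeg (c + dy s) w

NonNeg-start : ∀ {c} w → NonNeg c w → 0ℤ ≤ c
NonNeg-start [] 0≤c = 0≤c
NonNeg-start (_ ∷ _) (0≤c , _) = 0≤c

NonNeg-++ : ∀ c u w → NonNeg c u → NonNeg (c + ordinate u) w → NonNeg c (u ++ w)
NonNeg-++ c [] w _ nn = subst (λ z → NonNeg z w) (ℤP.+-identityʳ c) nn
NonNeg-++ c (s ∷ u) w (0≤c , nnu) nn =
  0≤c , NonNeg-++ (c + dy s) u w nnu (subst (λ z → NonNeg z w) (sym (ℤP.+-assoc c (dy s) (ordinate u))) nn)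

NonNeg-raise : ∀ c k w → 0ℤ ≤ k → NonNeg c w → NonNeg (c + k) w
NonNeg-raise c k [] 0≤k 0≤c = ℤP.+-mono-≤ 0≤c 0≤k
NonNeg-raise c k (s ∷ w) 0≤k (0≤c , nn) = ℤP.+-mono-≤ 0≤c 0≤k ,
  subst (λ z → NonNeg z w) (solve 3 (λ c d k → c :+ d :+ k := c :+ k :+ d) refl c (dy s) k)
    (NonNeg-raise (c + dy s) k w 0≤k nn)
  where open +-*-Solver

0≤maxPS : ∀ p → 0ℤ ≤ maxPS p
0≤maxPS [] = ℤP.≤-refl
0≤maxPS (s ∷ p) = ℤP.i≤i⊔j 0ℤ _

minPS≤0 : ∀ p → minPS p ≤ 0ℤ
minPS≤0 [] = ℤP.≤-refl
minPS≤0 (s ∷ p) = ℤP.i⊓j≤i 0ℤ _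

maxPS≡minPS+amplitude : ∀ p → maxPS p ≡ minPS p + amplitude p
maxPS≡minPS+amplitude p = solve 2 (λ a b → a := b :+ (a :- b)) refl (maxPS p) (minPS p)
  where open +-*-Solver

0≤amplitude : ∀ p → 0ℤ ≤ amplitude p
0≤amplitude p = ℤP.+-mono-≤ (0≤maxPS p) (ℤP.neg-mono-≤ (minPS≤0 p))

1≤amplitude : ∀ p → p ≢ [] → 1ℤ ≤ amplitude p
1≤amplitude [] p≢[] = ⊥-elim (p≢[] refl)
1≤amplitude (s ∷ p) _ = begin
  1ℤ                                ≡⟨ step-span s ⟩
  (0ℤ ⊔ dy s) - (0ℤ ⊓ dy s)          ≤⟨ ℤP.+-mono-≤ (ℤP.⊔-monoʳ-≤ 0ℤ (below (0≤maxPS p)))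
                                                    (ℤP.neg-mono-≤ (ℤP.⊓-monoʳ-≤ 0ℤ (below′ (minPS≤0 p)))) ⟩
  amplitude (s ∷ p)                 ∎
  where
  open ℤP.≤-Reasoning
  step-span : ∀ s → 1ℤ ≡ (0ℤ ⊔ dy s) - (0ℤ ⊓ dy s)
  step-span U = refl
  step-span D = refl
  step-span L = refl
  below : ∀ {x} → 0ℤ ≤ x → dy s ≤ dy s + x
  below {x} 0≤x = ℤP.≤-trans (ℤP.≤-reflexive (sym (ℤP.+-identityʳ (dy s)))) (ℤP.+-monoʳ-≤ (dy s) 0≤x)
  below′ : ∀ {x} → x ≤ 0ℤ → dy s + x ≤ dy s
  below′ {x} x≤0 = ℤP.≤-trans (ℤP.+-monoʳ-≤ (dy s) x≤0) (ℤP.≤-reflexive (ℤP.+-identityʳ (dy s)))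

==ₛ⇒≡ : ∀ {a b} → (a ==ₛ b) ≡ true → a ≡ b
==ₛ⇒≡ {U} {U} _ = refl
==ₛ⇒≡ {D} {D} _ = refl
==ₛ⇒≡ {L} {L} _ = refl
==ₛ⇒≡ {U} {D} ()
==ₛ⇒≡ {U} {L} ()
==ₛ⇒≡ {D} {U} ()
==ₛ⇒≡ {D} {L} ()
==ₛ⇒≡ {L} {U} ()
==ₛ⇒≡ {L} {D} ()

∧≡true⇒ : ∀ {a b} → (a ∧ b) ≡ true → a ≡ true × b ≡ true
∧≡true⇒ {true} {true} _ = refl , refl

isPrefix-∷⁻ : ∀ {a b} p w → isPrefix (a ∷ p) (b ∷ w) ≡ true → a ≡ b × isPrefix p w ≡ true
isPrefix-∷⁻ {a} {b} p w e with ∧≡true⇒ {a ==ₛ b} e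
... | a==b , p≼w = ==ₛ⇒≡ a==b , p≼w

isPrefix-++ : ∀ p u w → isPrefix p u ≡ true → isPrefix p (u ++ w) ≡ true
isPrefix-++ [] u w _ = refl
isPrefix-++ (a ∷ p) (b ∷ u) w e with ∧≡true⇒ {a ==ₛ b} e
... | a==b , p≼u rewrite a==b = isPrefix-++ p u w p≼u

==ₛ-refl : ∀ a → (a ==ₛ a) ≡ true
==ₛ-refl U = refl
==ₛ-refl D = refl
==ₛ-refl L = refl

isPrefix-[] : ∀ p → p ≢ [] → isPrefix p [] ≡ false
isPrefix-[] [] p≢[] = ⊥-elim (p≢[] refl)
isPrefix-[] (_ ∷ _) _ = refl

isPrefix⇒length≤ : ∀ p w → isPrefix p w ≡ true → length p ℕ.≤ length w
isPrefix⇒length≤ [] w _ = z≤n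
isPrefix⇒length≤ (a ∷ p) (b ∷ w) e = s≤s (isPrefix⇒length≤ p w (proj₂ (isPrefix-∷⁻ p w e)))

-- An occurrence running past u passes through the points at the end of u and one step later.
minPS-crossing : ∀ p u s w → isPrefix p (u ++ s ∷ w) ≡ true → isPrefix p u ≡ false →
  minPS p ≤ ordinate u ⊓ (ordinate u + dy s)
minPS-crossing (a ∷ p) [] s w e _ with isPrefix-∷⁻ p w e
... | refl , _ = ℤP.⊓-monoʳ-≤ 0ℤ (ℤP.≤-trans (ℤP.+-monoʳ-≤ (dy a) (minPS≤0 p))
                   (ℤP.≤-reflexive (trans (ℤP.+-identityʳ (dy a)) (sym (ℤP.+-identityˡ (dy a))))))
minPS-crossing (a ∷ p) (b ∷ u) s w e p⋠u with isPrefix-∷⁻ p (u ++ s ∷ w) e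
... | refl , p≼uw rewrite ==ₛ-refl a = begin
  0ℤ ⊓ (dy a + minPS p)                              ≤⟨ ℤP.i⊓j≤j 0ℤ _ ⟩
  dy a + minPS p                                     ≤⟨ ℤP.+-monoʳ-≤ (dy a) (minPS-crossing p u s w p≼uw p⋠u) ⟩
  dy a + (ordinate u ⊓ (ordinate u + dy s))          ≡⟨ ℤP.mono-≤-distrib-⊓ {f = λ z → dy a + z} (ℤP.+-monoʳ-≤ (dy a)) _ _ ⟩
  (dy a + ordinate u) ⊓ (dy a + (ordinate u + dy s)) ≡⟨ cong ((dy a + ordinate u) ⊓_) (sym (ℤP.+-assoc (dy a) _ _)) ⟩
  (dy a + ordinate u) ⊓ (dy a + ordinate u + dy s)   ∎
  where open ℤP.≤-Reasoning

NonNeg-isPrefix : ∀ p c w → NonNeg c w → isPrefix p w ≡ true → 0ℤ ≤ c + minPS p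
NonNeg-isPrefix [] c w nn _ = ℤP.≤-trans (NonNeg-start w nn) (ℤP.≤-reflexive (sym (ℤP.+-identityʳ c)))
NonNeg-isPrefix (a ∷ p) c (b ∷ w) (0≤c , nn) e with isPrefix-∷⁻ p w e
... | refl , p≼w = begin
  0ℤ                                  ≤⟨ ℤP.⊓-glb 0≤c (ℤP.≤-trans (NonNeg-isPrefix p (c + dy a) w nn p≼w)
                                                                (ℤP.≤-reflexive (ℤP.+-assoc c (dy a) (minPS p)))) ⟩
  c ⊓ (c + (dy a + minPS p))          ≡⟨ cong (_⊓ (c + (dy a + minPS p))) (sym (ℤP.+-identityʳ c)) ⟩
  (c + 0ℤ) ⊓ (c + (dy a + minPS p))   ≡⟨ sym (ℤP.mono-≤-distrib-⊓ {f = λ z → c + z} (ℤP.+-monoʳ-≤ c) 0ℤ _) ⟩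
  c + minPS (a ∷ p)                   ∎
  where open ℤP.≤-Reasoning

dy≤1 : ∀ s → dy s ≤ 1ℤ
dy≤1 U = ℤP.≤-refl
dy≤1 D = -≤+
dy≤1 L = -≤+

maxPS≤length : ∀ p → maxPS p ≤ + length p
maxPS≤length [] = ℤP.≤-refl
maxPS≤length (s ∷ p) = ℤP.⊔-lub (+≤+ z≤n)
  (ℤP.≤-trans (ℤP.+-monoʳ-≤ (dy s) (maxPS≤length p)) (ℤP.+-monoˡ-≤ (+ length p) (dy≤1 s)))

⊔-distribʳ-⊔ : ∀ k a b → (a ⊔ b) ⊔ k ≡ (a ⊔ k) ⊔ (b ⊔ k)
⊔-distribʳ-⊔ k a b = begin
  (a ⊔ b) ⊔ k         ≡⟨ ℤP.⊔-assoc a b k ⟩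
  a ⊔ (b ⊔ k)         ≡⟨ cong (a ⊔_) (ℤP.⊔-comm b k) ⟩
  a ⊔ (k ⊔ b)         ≡⟨ cong (λ z → a ⊔ (z ⊔ b)) (sym (ℤP.⊔-idem k)) ⟩
  a ⊔ ((k ⊔ k) ⊔ b)   ≡⟨ cong (a ⊔_) (trans (ℤP.⊔-assoc k k b) (cong (k ⊔_) (ℤP.⊔-comm k b))) ⟩
  a ⊔ (k ⊔ (b ⊔ k))   ≡⟨ sym (ℤP.⊔-assoc a k (b ⊔ k)) ⟩
  (a ⊔ k) ⊔ (b ⊔ k)   ∎
  where open ≡-Reasoning

+-distribʳ-⊔ : ∀ k a b → (a ⊔ b) + k ≡ (a + k) ⊔ (b + k)
+-distribʳ-⊔ k = ℤP.mono-≤-distrib-⊔ {f = λ x → x + k} (ℤP.+-monoˡ-≤ k)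

Excursion : List Step → Set
Excursion α = NonNeg 0ℤ α × ordinate α ≡ 0ℤ

module Occurrences (π : List Step) (π≢[] : π ≢ []) where

  r : ℤ
  r = amplitude π

  hBefore : ℤ → List Step → List Step → ℤ
  hBefore c [] w = 0ℤ
  hBefore c (s ∷ u) w = occ π c (s ∷ u ++ w) ⊔ hBefore (c + dy s) u w

  CrossingBound : ℤ → List Step → ℤ → Set
  CrossingBound J w M = ∀ c u → c + ordinate u ≡ J → isPrefix π (u ++ w) ≡ true → isPrefix π u ≡ false →
    c + maxPS π ≤ M

  crossing-height : ∀ J s w → CrossingBound J (s ∷ w) (J ⊓ (J + dy s) + r)
  crossing-height J s w c u c+u≡J π≼uw π⋠u = begin
    c + maxPS π                                               ≡⟨ cong (λ z → c + z) (maxPS≡minPS+amplitude π) ⟩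
    c + (minPS π + r)                                         ≡⟨ sym (ℤP.+-assoc c (minPS π) r) ⟩
    c + minPS π + r                                           ≤⟨ ℤP.+-monoˡ-≤ r (ℤP.+-monoʳ-≤ c (minPS-crossing π u s w π≼uw π⋠u)) ⟩
    c + (ordinate u ⊓ (ordinate u + dy s)) + r                ≡⟨ cong (_+ r) (ℤP.mono-≤-distrib-⊓ {f = λ z → c + z} (ℤP.+-monoʳ-≤ c) _ _) ⟩
    (c + ordinate u) ⊓ (c + (ordinate u + dy s)) + r          ≡⟨ cong (λ z → (c + ordinate u) ⊓ z + r) (sym (ℤP.+-assoc c _ (dy s))) ⟩
    (c + ordinate u) ⊓ (c + ordinate u + dy s) + r            ≡⟨ cong (λ z → z ⊓ (z + dy s) + r) c+u≡J ⟩
    J ⊓ (J + dy s) + r                                        ∎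
    where open ℤP.≤-Reasoning

  crossing-at-0 : ∀ w → CrossingBound 0ℤ w r
  crossing-at-0 [] c u _ π≼u π⋠u
    with () ← trans (sym π⋠u) (subst (λ z → isPrefix π z ≡ true) (ListP.++-identityʳ u) π≼u)
  crossing-at-0 (s ∷ w) c u c+u≡0 π≼uw π⋠u = ℤP.≤-trans (crossing-height 0ℤ s w c u c+u≡0 π≼uw π⋠u)
    (ℤP.≤-trans (ℤP.+-monoˡ-≤ r (ℤP.i⊓j≤i 0ℤ (0ℤ + dy s))) (ℤP.≤-reflexive (ℤP.+-identityˡ r)))

  crossing-before-down : ∀ s → dy s ≡ - 1ℤ → CrossingBound 1ℤ (s ∷ []) r
  crossing-before-down s ds c u c+u≡1 π≼us π⋠u = ℤP.≤-trans (crossing-height 1ℤ s [] c u c+u≡1 π≼us π⋠u)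
    (ℤP.≤-reflexive (trans (cong (λ d → 1ℤ ⊓ (1ℤ + d) + r) ds) (ℤP.+-identityˡ r)))

  hAux-[] : ∀ c → hAux π c [] ≡ 0ℤ
  hAux-[] c rewrite isPrefix-[] π π≢[] = refl

  occ-nonneg : ∀ c w → 0ℤ ≤ c → 0ℤ ≤ occ π c w
  occ-nonneg c w 0≤c with isPrefix π w
  ... | true = ℤP.+-mono-≤ 0≤c (0≤maxPS π)
  ... | false = ℤP.≤-refl

  hAux-nonneg : ∀ c w → 0ℤ ≤ hAux π c w
  hAux-nonneg c [] = ℤP.≤-reflexive (sym (hAux-[] c))
  hAux-nonneg c (s ∷ w) = ℤP.i≤j⇒i≤k⊔j _ (hAux-nonneg (c + dy s) w)

  occ-at-0 : ∀ w → occ π 0ℤ w ≤ r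
  occ-at-0 w with isPrefix π w
  ... | true = ℤP.≤-trans (ℤP.≤-reflexive (trans (ℤP.+-identityˡ (maxPS π)) (sym (ℤP.+-identityʳ (maxPS π)))))
                 (ℤP.+-monoʳ-≤ (maxPS π) (ℤP.neg-mono-≤ (minPS≤0 π)))
  ... | false = 0≤amplitude π

  occ-raise : ∀ c k w → occ π (c + k) w ≡ occ π c w + k ⊎ (occ π (c + k) w ≡ 0ℤ × occ π c w ≡ 0ℤ)
  occ-raise c k w with isPrefix π w
  ... | true = inj₁ (solve 3 (λ c k m → (c :+ k) :+ m := (c :+ m) :+ k) refl c k (maxPS π))
    where open +-*-Solver
  ... | false = inj₂ (refl , refl)

  private
    +-swapʳ : ∀ c k d → c + k + d ≡ c + d + k
    +-swapʳ c k d = solve 3 (λ c k d → c :+ k :+ d := c :+ d :+ k) refl c k d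
      where open +-*-Solver

  hAux-raise-≤ : ∀ c k w → 0ℤ ≤ k → hAux π (c + k) w ≤ hAux π c w + k
  hAux-raise-≤ c k [] 0≤k rewrite hAux-[] (c + k) | hAux-[] c = ℤP.≤-trans 0≤k (ℤP.≤-reflexive (sym (ℤP.+-identityˡ k)))
  hAux-raise-≤ c k (s ∷ w) 0≤k = begin
    occ π (c + k) (s ∷ w) ⊔ hAux π (c + k + dy s) w     ≤⟨ ℤP.⊔-mono-≤ at-start rest ⟩
    (occ π c (s ∷ w) + k) ⊔ (hAux π (c + dy s) w + k)   ≡⟨ sym (+-distribʳ-⊔ k (occ π c (s ∷ w)) _) ⟩
    (occ π c (s ∷ w) ⊔ hAux π (c + dy s) w) + k         ∎
    where
    open ℤP.≤-Reasoning
    rest : hAux π (c + k + dy s) w ≤ hAux π (c + dy s) w + k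
    rest = ℤP.≤-trans (ℤP.≤-reflexive (cong (λ z → hAux π z w) (+-swapʳ c k (dy s)))) (hAux-raise-≤ (c + dy s) k w 0≤k)
    at-start : occ π (c + k) (s ∷ w) ≤ occ π c (s ∷ w) + k
    at-start with occ-raise c k (s ∷ w)
    ... | inj₁ e = ℤP.≤-reflexive e
    ... | inj₂ (e₁ , e₂) rewrite e₁ | e₂ = ℤP.≤-trans 0≤k (ℤP.≤-reflexive (sym (ℤP.+-identityˡ k)))

  hAux-raise-≥ : ∀ c k w → hAux π c w + k ≤ hAux π (c + k) w ⊔ k
  hAux-raise-≥ c k [] rewrite hAux-[] (c + k) | hAux-[] c = ℤP.≤-trans (ℤP.≤-reflexive (ℤP.+-identityˡ k)) (ℤP.i≤j⊔i 0ℤ k)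
  hAux-raise-≥ c k (s ∷ w) = begin
    (occ π c (s ∷ w) ⊔ hAux π (c + dy s) w) + k                  ≡⟨ +-distribʳ-⊔ k (occ π c (s ∷ w)) _ ⟩
    (occ π c (s ∷ w) + k) ⊔ (hAux π (c + dy s) w + k)            ≤⟨ ℤP.⊔-mono-≤ at-start rest ⟩
    (occ π (c + k) (s ∷ w) ⊔ k) ⊔ (hAux π (c + k + dy s) w ⊔ k)  ≡⟨ sym (⊔-distribʳ-⊔ k (occ π (c + k) (s ∷ w)) _) ⟩
    (occ π (c + k) (s ∷ w) ⊔ hAux π (c + k + dy s) w) ⊔ k        ∎
    where
    open ℤP.≤-Reasoning
    rest : hAux π (c + dy s) w + k ≤ hAux π (c + k + dy s) w ⊔ k
    rest = ℤP.≤-trans (hAux-raise-≥ (c + dy s) k w) (ℤP.≤-reflexive (cong (λ z → hAux π z w ⊔ k) (sym (+-swapʳ c k (dy s)))))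
    at-start : occ π c (s ∷ w) + k ≤ occ π (c + k) (s ∷ w) ⊔ k
    at-start with occ-raise c k (s ∷ w)
    ... | inj₁ e = ℤP.i≤j⇒i≤j⊔k k (ℤP.≤-reflexive (sym e))
    ... | inj₂ (e₁ , e₂) rewrite e₁ | e₂ = ℤP.≤-trans (ℤP.≤-reflexive (ℤP.+-identityˡ k)) (ℤP.i≤j⊔i 0ℤ k)

  hAux-++ : ∀ c u w → hAux π c (u ++ w) ≡ hBefore c u w ⊔ hAux π (c + ordinate u) w
  hAux-++ c [] w = sym (trans (ℤP.i≤j⇒i⊔j≡j (hAux-nonneg (c + 0ℤ) w)) (cong (λ z → hAux π z w) (ℤP.+-identityʳ c)))
  hAux-++ c (s ∷ u) w = begin
    occ π c (s ∷ u ++ w) ⊔ hAux π (c + dy s) (u ++ w)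
      ≡⟨ cong (occ π c (s ∷ u ++ w) ⊔_) (hAux-++ (c + dy s) u w) ⟩
    occ π c (s ∷ u ++ w) ⊔ (hBefore (c + dy s) u w ⊔ hAux π (c + dy s + ordinate u) w)
      ≡⟨ sym (ℤP.⊔-assoc _ _ _) ⟩
    (occ π c (s ∷ u ++ w) ⊔ hBefore (c + dy s) u w) ⊔ hAux π (c + dy s + ordinate u) w
      ≡⟨ cong (λ z → hBefore c (s ∷ u) w ⊔ hAux π z w) (ℤP.+-assoc c (dy s) (ordinate u)) ⟩
    hBefore c (s ∷ u) w ⊔ hAux π (c + ordinate (s ∷ u)) w ∎
    where open ≡-Reasoning

  hAux≤hBefore : ∀ c u w → NonNeg c u → hAux π c u ≤ hBefore c u w
  hAux≤hBefore c [] w _ rewrite hAux-[] c = ℤP.≤-refl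
  hAux≤hBefore c (s ∷ u) w (0≤c , nn) = ℤP.⊔-mono-≤ at-start (hAux≤hBefore (c + dy s) u w nn)
    where
    at-start : occ π c (s ∷ u) ≤ occ π c (s ∷ u ++ w)
    at-start with isPrefix π (s ∷ u) in π≼su
    ... | true rewrite isPrefix-++ π (s ∷ u) w π≼su = ℤP.≤-refl
    ... | false = occ-nonneg c (s ∷ u ++ w) 0≤c

  hBefore≤hAux⊔ : ∀ {J w M} → 0ℤ ≤ M → CrossingBound J w M →
    ∀ c u → c + ordinate u ≡ J → hBefore c u w ≤ hAux π c u ⊔ M
  hBefore≤hAux⊔ 0≤M _ c [] _ = ℤP.i≤j⇒i≤k⊔j (hAux π c []) 0≤M
  hBefore≤hAux⊔ {J} {w} {M} 0≤M crossing c (s ∷ u) c+su≡J = begin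
    occ π c (s ∷ u ++ w) ⊔ hBefore (c + dy s) u w            ≤⟨ ℤP.⊔-mono-≤ at-start rest ⟩
    (occ π c (s ∷ u) ⊔ M) ⊔ (hAux π (c + dy s) u ⊔ M)        ≡⟨ sym (⊔-distribʳ-⊔ M _ _) ⟩
    hAux π c (s ∷ u) ⊔ M                                     ∎
    where
    open ℤP.≤-Reasoning
    rest = hBefore≤hAux⊔ 0≤M crossing (c + dy s) u (trans (ℤP.+-assoc c (dy s) (ordinate u)) c+su≡J)
    at-start : occ π c (s ∷ u ++ w) ≤ occ π c (s ∷ u) ⊔ M
    at-start with isPrefix π (s ∷ u ++ w) in π≼suw
    ... | false = ℤP.i≤j⇒i≤k⊔j _ 0≤M
    ... | true with isPrefix π (s ∷ u) in π≼su
    ...   | true = ℤP.i≤i⊔j _ M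
    ...   | false = ℤP.i≤j⇒i≤k⊔j 0ℤ (crossing c (s ∷ u) c+su≡J π≼suw π≼su)

  hAux-++-≥ : ∀ c u w → NonNeg c u → hAux π c u ≤ hAux π c (u ++ w)
  hAux-++-≥ c u w nn = ℤP.≤-trans (hAux≤hBefore c u w nn)
    (ℤP.≤-trans (ℤP.i≤i⊔j _ _) (ℤP.≤-reflexive (sym (hAux-++ c u w))))

  hAux-++-≤ : ∀ {J w M} → 0ℤ ≤ M → CrossingBound J w M →
    ∀ c u → c + ordinate u ≡ J → hAux π c (u ++ w) ≤ (hAux π c u ⊔ M) ⊔ hAux π J w
  hAux-++-≤ {J} {w} 0≤M crossing c u c+u≡J = ℤP.≤-trans (ℤP.≤-reflexive (hAux-++ c u w))
    (ℤP.⊔-mono-≤ (hBefore≤hAux⊔ 0≤M crossing c u c+u≡J) (ℤP.≤-reflexive (cong (λ z → hAux π z w) c+u≡J)))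

  Gap : ℤ → Set
  Gap x = x ≡ 0ℤ ⊎ r ≤ x

  Gap-⊔ : ∀ {x y} → Gap x → Gap y → Gap (x ⊔ y)
  Gap-⊔ (inj₁ refl) (inj₁ refl) = inj₁ refl
  Gap-⊔ {x} (inj₁ _) (inj₂ r≤y) = inj₂ (ℤP.i≤j⇒i≤k⊔j x r≤y)
  Gap-⊔ {y = y} (inj₂ r≤x) _ = inj₂ (ℤP.i≤j⇒i≤j⊔k y r≤x)

  -- An occurrence never dips below 0, so its lowest point is at least 0 and its top at least r.
  hAux-gap : ∀ c w → NonNeg c w → Gap (hAux π c w)
  hAux-gap c [] _ = inj₁ (hAux-[] c)
  hAux-gap c (s ∷ w) (0≤c , nn) = Gap-⊔ at-start (hAux-gap (c + dy s) w nn)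
    where
    at-start : Gap (occ π c (s ∷ w))
    at-start with isPrefix π (s ∷ w) in π≼sw
    ... | false = inj₁ refl
    ... | true = inj₂ (begin
      r                    ≡⟨ sym (ℤP.+-identityˡ r) ⟩
      0ℤ + r               ≤⟨ ℤP.+-monoˡ-≤ r (NonNeg-isPrefix π c (s ∷ w) (0≤c , nn) π≼sw) ⟩
      c + minPS π + r      ≡⟨ ℤP.+-assoc c (minPS π) r ⟩
      c + (minPS π + r)    ≡⟨ cong (λ z → c + z) (sym (maxPS≡minPS+amplitude π)) ⟩
      c + maxPS π          ∎)
      where open ℤP.≤-Reasoning

  hAux≤+length : ∀ c w → NonNeg c w → hAux π c w ≤ c + + length w
  hAux≤+length c [] nn rewrite hAux-[] c = ℤP.≤-trans nn (ℤP.≤-reflexive (sym (ℤP.+-identityʳ c)))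
  hAux≤+length c (s ∷ w) (0≤c , nn) = ℤP.⊔-lub at-start (ℤP.≤-trans (hAux≤+length (c + dy s) w nn) rest)
    where
    open ℤP.≤-Reasoning
    rest : c + dy s + + length w ≤ c + + length (s ∷ w)
    rest = begin
      c + dy s + + length w         ≡⟨ ℤP.+-assoc c (dy s) _ ⟩
      c + (dy s + + length w)       ≤⟨ ℤP.+-monoʳ-≤ c (ℤP.+-monoˡ-≤ (+ length w) (dy≤1 s)) ⟩
      c + + length (s ∷ w)          ∎
    at-start : occ π c (s ∷ w) ≤ c + + length (s ∷ w)
    at-start with isPrefix π (s ∷ w) in π≼sw
    ... | true = ℤP.+-monoʳ-≤ c (ℤP.≤-trans (maxPS≤length π) (+≤+ (isPrefix⇒length≤ π (s ∷ w) π≼sw)))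
    ... | false = ℤP.≤-trans 0≤c (ℤP.≤-trans (ℤP.≤-reflexive (sym (ℤP.+-identityʳ c))) (ℤP.+-monoʳ-≤ c (+≤+ z≤n)))

  h-gap : ∀ {α} → Excursion α → Gap (h π α)
  h-gap (nn , _) = hAux-gap 0ℤ _ nn

  0<h⇒r≤h : ∀ {α} → Excursion α → 0ℤ < h π α → r ≤ h π α
  0<h⇒r≤h {α} ex 0<h with h-gap ex
  ... | inj₁ h≡0 = ⊥-elim (ℤP.<-irrefl (sym h≡0) 0<h)
  ... | inj₂ r≤h = r≤h

  module _ {α s} (ex : Excursion α) (s-down : dy s ≡ - 1ℤ) where

    private
      α-from-1 : NonNeg 1ℤ α
      α-from-1 = NonNeg-raise 0ℤ 1ℤ α (+≤+ z≤n) (proj₁ ex)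

      last-step : hAux π 1ℤ (s ∷ []) ≤ r
      last-step = ℤP.⊔-lub at-start (ℤP.≤-trans (ℤP.≤-reflexive (hAux-[] (1ℤ + dy s))) (0≤amplitude π))
        where
        at-start : occ π 1ℤ (s ∷ []) ≤ r
        at-start with isPrefix π (s ∷ []) in π≼s
        ... | true = crossing-before-down s s-down 1ℤ [] refl π≼s (isPrefix-[] π π≢[])
        ... | false = 0≤amplitude π

    h-elevate-≤ : h π (U ∷ α ++ s ∷ []) ≤ r ⊔ (h π α + 1ℤ)
    h-elevate-≤ = ℤP.⊔-lub (ℤP.≤-trans (occ-at-0 _) (ℤP.i≤i⊔j r _)) (begin
      hAux π 1ℤ (α ++ s ∷ [])                    ≤⟨ hAux-++-≤ (0≤amplitude π) (crossing-before-down s s-down) 1ℤ α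
                                                      (cong (λ z → 1ℤ + z) (proj₂ ex)) ⟩
      (hAux π 1ℤ α ⊔ r) ⊔ hAux π 1ℤ (s ∷ [])    ≤⟨ ℤP.⊔-lub (ℤP.⊔-lub (ℤP.i≤j⇒i≤k⊔j r (hAux-raise-≤ 0ℤ 1ℤ α (+≤+ z≤n)))
                                                                         (ℤP.i≤i⊔j r _))
                                                              (ℤP.i≤j⇒i≤j⊔k _ last-step) ⟩
      r ⊔ (h π α + 1ℤ)                          ∎)
      where open ℤP.≤-Reasoning

    h-elevate-≥ : h π α + 1ℤ ≤ h π (U ∷ α ++ s ∷ []) ⊔ 1ℤ
    h-elevate-≥ = ℤP.≤-trans (hAux-raise-≥ 0ℤ 1ℤ α)
      (ℤP.⊔-monoˡ-≤ 1ℤ (ℤP.≤-trans (hAux-++-≥ 1ℤ α (s ∷ []) α-from-1) (ℤP.i≤j⊔i _ _)))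

    h-elevate-zero : h π α ≡ 0ℤ → h π (U ∷ α ++ s ∷ []) ≤ r
    h-elevate-zero h≡0 = ℤP.≤-trans h-elevate-≤
      (ℤP.⊔-lub ℤP.≤-refl (ℤP.≤-trans (ℤP.≤-reflexive (cong (_+ 1ℤ) h≡0)) (1≤amplitude π π≢[])))

    h-elevate-pos : 0ℤ < h π α → h π (U ∷ α ++ s ∷ []) ≡ h π α + 1ℤ
    h-elevate-pos 0<h = ℤP.≤-antisym
      (ℤP.≤-trans h-elevate-≤ (ℤP.⊔-lub (ℤP.≤-trans (0<h⇒r≤h ex 0<h) (ℤP.i≤i+j _ 1ℤ)) ℤP.≤-refl))
      (drop-⊔1 h-elevate-≥)
      where
      drop-⊔1 : ∀ {y} → h π α + 1ℤ ≤ y ⊔ 1ℤ → h π α + 1ℤ ≤ y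
      drop-⊔1 {y} le with ℤP.⊔-sel y 1ℤ
      ... | inj₁ e = ℤP.≤-trans le (ℤP.≤-reflexive e)
      ... | inj₂ e = ⊥-elim (ℤP.<-irrefl refl (ℤP.<-≤-trans (ℤP.+-monoˡ-< 1ℤ 0<h) (ℤP.≤-trans le (ℤP.≤-reflexive e))))

  module _ {p β} (ex : Excursion p) (β≤p : h π β ≤ h π p) where

    private
      h-++-≤ : h π (p ++ β) ≤ (h π p ⊔ r) ⊔ h π β
      h-++-≤ = hAux-++-≤ (0≤amplitude π) (crossing-at-0 β) 0ℤ p (trans (ℤP.+-identityˡ _) (proj₂ ex))

    h-++-pos : 0ℤ < h π p → h π (p ++ β) ≡ h π p
    h-++-pos 0<h = ℤP.≤-antisym
      (ℤP.≤-trans h-++-≤ (ℤP.⊔-lub (ℤP.⊔-lub ℤP.≤-refl (0<h⇒r≤h ex 0<h)) β≤p))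
      (hAux-++-≥ 0ℤ p β (proj₁ ex))

    h-++-zero : h π p ≡ 0ℤ → h π (p ++ β) ≤ r
    h-++-zero h≡0 = ℤP.≤-trans h-++-≤
      (ℤP.⊔-lub (ℤP.⊔-lub p≤r ℤP.≤-refl) (ℤP.≤-trans β≤p p≤r))
      where
      p≤r : h π p ≤ r
      p≤r = ℤP.≤-trans (ℤP.≤-reflexive h≡0) (0≤amplitude π)

-- First return decompositions

no-dip : ∀ {c} s w → c + 0ℤ ≡ 0ℤ → dy s ≡ - 1ℤ → NonNeg c (s ∷ w) → ⊥
no-dip {c} s w c≡0 s-down (_ , nn) with NonNeg-start w nn
... | 0≤c+s rewrite ℤP.+-identityʳ c | c≡0 | s-down with 0≤c+s
...   | ()

first-return-unique : ∀ {c α α′ s s′ β β′} → NonNeg c α → NonNeg c α′ →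
  c + ordinate α ≡ 0ℤ → c + ordinate α′ ≡ 0ℤ → dy s ≡ - 1ℤ → dy s′ ≡ - 1ℤ →
  α ++ s ∷ β ≡ α′ ++ s′ ∷ β′ → α ≡ α′ × s ≡ s′ × β ≡ β′
first-return-unique {α = []} {[]} _ _ _ _ _ _ e with ListP.∷-injective e
... | refl , refl = refl , refl , refl
first-return-unique {c} {α = []} {a ∷ α′} _ nn′ c≡0 _ s-down _ e with ListP.∷-injective e
... | refl , _ = ⊥-elim (no-dip a α′ c≡0 s-down nn′)
first-return-unique {c} {α = a ∷ α} {[]} nn _ _ c≡0 _ s′-down e with ListP.∷-injective e
... | refl , _ = ⊥-elim (no-dip a α c≡0 s′-down nn)
first-return-unique {c} {α = a ∷ α} {a′ ∷ α′} (_ , nn) (_ , nn′) e₁ e₂ s-down s′-down e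
  with ListP.∷-injective e
... | refl , e′ with first-return-unique nn nn′ (trans (ℤP.+-assoc c (dy a) _) e₁) (trans (ℤP.+-assoc c (dy a) _) e₂) s-down s′-down e′
...   | refl , refl , refl = refl , refl , refl

Excursion-elevate : ∀ {α s β} → Excursion α → dy s ≡ - 1ℤ → Excursion β → Excursion (U ∷ α ++ s ∷ β)
Excursion-elevate {α} {s} {β} (nnα , ordα) s-down (nnβ , ordβ) =
  (+≤+ z≤n , NonNeg-++ 1ℤ α (s ∷ β) (NonNeg-raise 0ℤ 1ℤ α (+≤+ z≤n) nnα) nn-sβ) , returns
  where
  nn-sβ : NonNeg (1ℤ + ordinate α) (s ∷ β)
  nn-sβ rewrite ordα | s-down = +≤+ z≤n , nnβ
  returns : 1ℤ + ordinate (α ++ s ∷ β) ≡ 0ℤ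
  returns rewrite ordinate-++ α (s ∷ β) | ordα | s-down | ordβ = refl

InA⇒Excursion : ∀ {π P} → InA π P → Excursion P
InA⇒Excursion nil = ℤP.≤-refl , refl
InA⇒Excursion (ud α∈A β∈A _) = Excursion-elevate (InA⇒Excursion α∈A) refl (InA⇒Excursion β∈A)
InA⇒Excursion (ul α∈A _) = Excursion-elevate (InA⇒Excursion α∈A) refl (ℤP.≤-refl , refl)

private
  down-up : ∀ o l → (- 1ℤ + o) + (1ℤ + l) ≡ o + l
  down-up = solve 2 (λ o l → (:- con 1ℤ :+ o) :+ (con 1ℤ :+ l) := o :+ l) refl
    where open +-*-Solver

ordinate+length : ∀ w → ordinate w + + length w ≡ + (2 ℕ.* semilength w)
ordinate+length [] = refl
ordinate+length (U ∷ w) = begin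
  (1ℤ + ordinate w) + (1ℤ + + length w)   ≡⟨ solve 2 (λ o l → (con 1ℤ :+ o) :+ (con 1ℤ :+ l) := con (+ 2) :+ (o :+ l)) refl
                                               (ordinate w) (+ length w) ⟩
  + 2 + (ordinate w + + length w)         ≡⟨ cong (λ z → + 2 + z) (ordinate+length w) ⟩
  + (2 ℕ.+ 2 ℕ.* semilength w)            ≡⟨ cong +_ (sym (ℕP.*-suc 2 (semilength w))) ⟩
  + (2 ℕ.* suc (semilength w))            ∎
  where
  open ≡-Reasoning
  open +-*-Solver
ordinate+length (D ∷ w) = trans (down-up (ordinate w) (+ length w)) (ordinate+length w)
ordinate+length (L ∷ w) = trans (down-up (ordinate w) (+ length w)) (ordinate+length w)

h≤2*semilength : ∀ π → π ≢ [] → ∀ {P} → Excursion P → h π P ≤ + (2 ℕ.* semilength P)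
h≤2*semilength π π≢[] {P} (nn , ord) = begin
  h π P                     ≤⟨ Occurrences.hAux≤+length π π≢[] 0ℤ P nn ⟩
  0ℤ + + length P           ≡⟨ cong (_+ + length P) (sym ord) ⟩
  ordinate P + + length P   ≡⟨ ordinate+length P ⟩
  + (2 ℕ.* semilength P)    ∎
  where open ℤP.≤-Reasoning

semilength-++ : ∀ u w → semilength (u ++ w) ≡ semilength u ℕ.+ semilength w
semilength-++ [] w = refl
semilength-++ (U ∷ u) w = cong suc (semilength-++ u w)
semilength-++ (D ∷ u) w = semilength-++ u w
semilength-++ (L ∷ u) w = semilength-++ u w

-- Counting with duplicate-free lists

private
  variable
    A B C : Set

length-≡-unique : ∀ {xs ys : List A} → Unique xs → Unique ys →
  (∀ {w} → w ∈ xs → w ∈ ys) → (∀ {w} → w ∈ ys → w ∈ xs) → length xs ≡ length ys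
length-≡-unique xs! ys! xs⊆ys ys⊆xs = ↭-length (∼bag⇒↭ (unique∧set⇒bag xs! ys! (mk⇔ xs⊆ys ys⊆xs)))

length-filter-⊎ : ∀ {P Q R : Pred A Level.zero} (P? : Decidable P) (Q? : Decidable Q) (R? : Decidable R) xs →
  (∀ x → x ∈ xs → P x → Q x ⊎ R x) → (∀ x → x ∈ xs → Q x ⊎ R x → P x) → (∀ x → Q x → R x → ⊥) →
  length (filter P? xs) ≡ length (filter Q? xs) ℕ.+ length (filter R? xs)
length-filter-⊎ P? Q? R? [] _ _ _ = refl
length-filter-⊎ P? Q? R? (x ∷ xs) P⇒Q⊎R Q⊎R⇒P Q∩R
  with P? x | Q? x | R? x | length-filter-⊎ P? Q? R? xs (λ y → P⇒Q⊎R y ∘ there) (λ y → Q⊎R⇒P y ∘ there) Q∩R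
... | yes _ | yes q | yes r | _ = ⊥-elim (Q∩R x q r)
... | yes _ | yes _ | no _ | rest = cong suc rest
... | yes _ | no _ | yes _ | rest = trans (cong suc rest) (sym (ℕP.+-suc _ _))
... | yes p | no ¬q | no ¬r | _ = ⊥-elim ([ ¬q , ¬r ]′ (P⇒Q⊎R x (here refl) p))
... | no ¬p | yes q | _ | _ = ⊥-elim (¬p (Q⊎R⇒P x (here refl) (inj₁ q)))
... | no ¬p | no _ | yes r | _ = ⊥-elim (¬p (Q⊎R⇒P x (here refl) (inj₂ r)))
... | no _ | no _ | no _ | rest = rest

Unique-map⁺-on : ∀ (f : A → B) {xs} → (∀ {x y} → x ∈ xs → y ∈ xs → f x ≡ f y → x ≡ y) →
  Unique xs → Unique (map f xs)
Unique-map⁺-on f {[]} _ [] = []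
Unique-map⁺-on f {x ∷ xs} inj (x∉xs ∷ xs!) =
  AllP.map⁺ (All.tabulate (λ y∈xs fx≡fy → All.lookup x∉xs y∈xs (inj (here refl) (there y∈xs) fx≡fy)))
  ∷ Unique-map⁺-on f (λ x∈ y∈ → inj (there x∈) (there y∈)) xs!

Unique-cartesianProductWith⁺-on : ∀ (f : A → B → C) {xs ys} →
  (∀ {a a′ b b′} → a ∈ xs → a′ ∈ xs → b ∈ ys → b′ ∈ ys → f a b ≡ f a′ b′ → a ≡ a′ × b ≡ b′) →
  Unique xs → Unique ys → Unique (cartesianProductWith f xs ys)
Unique-cartesianProductWith⁺-on f {[]} _ _ _ = []
Unique-cartesianProductWith⁺-on f {x ∷ xs} {ys} inj (x∉xs ∷ xs!) ys! = UniqueP.++⁺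
  (Unique-map⁺-on (f x) (λ b∈ b′∈ e → proj₂ (inj (here refl) (here refl) b∈ b′∈ e)) ys!)
  (Unique-cartesianProductWith⁺-on f (λ a∈ a′∈ → inj (there a∈) (there a′∈)) xs! ys!)
  disjoint
  where
  disjoint : Disjoint (map (f x) ys) (cartesianProductWith f xs ys)
  disjoint (v∈fx , v∈rest) with ∈-map⁻ (f x) v∈fx | ∈-cartesianProductWith⁻ f xs ys v∈rest
  ... | b , b∈ , v≡fxb | a , b′ , a∈ , b′∈ , v≡fab′ =
    All.lookup x∉xs a∈ (proj₁ (inj (here refl) (there a∈) b∈ b′∈ (trans (sym v≡fxb) v≡fab′)))

length-cartesianProductWith : ∀ (f : A → B → C) xs ys →
  length (cartesianProductWith f xs ys) ≡ length xs ℕ.* length ys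
length-cartesianProductWith f [] ys = refl
length-cartesianProductWith f (x ∷ xs) ys = begin
  length (map (f x) ys ++ cartesianProductWith f xs ys)           ≡⟨ ListP.length-++ (map (f x) ys) ⟩
  length (map (f x) ys) ℕ.+ length (cartesianProductWith f xs ys) ≡⟨ cong₂ ℕ._+_ (ListP.length-map (f x) ys)
                                                                        (length-cartesianProductWith f xs ys) ⟩
  length ys ℕ.+ length xs ℕ.* length ys                           ∎
  where open ≡-Reasoning

unionUpTo : (ℕ → List A) → ℕ → List A
unionUpTo g zero = g 0
unionUpTo g (suc n) = unionUpTo g n ++ g (suc n)

∈-unionUpTo⁺ : ∀ (g : ℕ → List A) {n i x} → i ℕ.≤ n → x ∈ g i → x ∈ unionUpTo g n
∈-unionUpTo⁺ g {zero} z≤n x∈ = x∈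
∈-unionUpTo⁺ g {suc n} i≤1+n x∈ with ℕP.m≤n⇒m<n∨m≡n i≤1+n
... | inj₁ i<1+n = ∈-++⁺ˡ (∈-unionUpTo⁺ g (ℕP.≤-pred i<1+n) x∈)
... | inj₂ refl = ∈-++⁺ʳ (unionUpTo g n) x∈

∈-unionUpTo⁻ : ∀ (g : ℕ → List A) n {x} → x ∈ unionUpTo g n → ∃ λ i → i ℕ.≤ n × x ∈ g i
∈-unionUpTo⁻ g zero x∈ = 0 , z≤n , x∈
∈-unionUpTo⁻ g (suc n) x∈ with ∈-++⁻ (unionUpTo g n) x∈
... | inj₂ x∈last = suc n , ℕP.≤-refl , x∈last
... | inj₁ x∈init with ∈-unionUpTo⁻ g n x∈init
...   | i , i≤n , x∈gi = i , ℕP.m≤n⇒m≤1+n i≤n , x∈gi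

Unique-unionUpTo : ∀ (g : ℕ → List A) n → (∀ i → Unique (g i)) →
  (∀ {i i′ x} → x ∈ g i → x ∈ g i′ → i ≡ i′) → Unique (unionUpTo g n)
Unique-unionUpTo g zero g! _ = g! 0
Unique-unionUpTo g (suc n) g! disjoint = UniqueP.++⁺ (Unique-unionUpTo g n g! disjoint) (g! (suc n)) last-new
  where
  last-new : Disjoint (unionUpTo g n) (g (suc n))
  last-new (x∈init , x∈last) with ∈-unionUpTo⁻ g n x∈init
  ... | i , i≤n , x∈gi = ℕP.<-irrefl (disjoint x∈gi x∈last) (s≤s i≤n)

length-unionUpTo : ∀ (g : ℕ → List A) n → + length (unionUpTo g n) ≡ sumTo (λ i → + length (g i)) n
length-unionUpTo g zero = refl
length-unionUpTo g (suc n) rewrite ListP.length-++ (unionUpTo g n) {g (suc n)} =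
  trans (ℤP.pos-+ (length (unionUpTo g n)) _) (cong (_+ + length (g (suc n))) (length-unionUpTo g n))

Count-filter : ∀ {P : List Step → Set} {Q : Pred (List Step) Level.zero} (Q? : Decidable Q) {n c}
  (C : Count P n c) → Count (λ w → P w × Q w) n (length (filter Q? (proj₁ C)))
Count-filter {P} {Q} Q? {n} (ws , ws! , ∈ws , _) = filter Q? ws , UniqueP.filter⁺ Q? ws! , ∈filter , refl
  where
  ∈filter : ∀ w → (w ∈ filter Q? ws) ⇔ ((P w × Q w) × semilength w ≡ n)
  ∈filter w = mk⇔
    (λ w∈ → let w∈ws , Qw = ∈-filter⁻ Q? {xs = ws} w∈ ; Pw , sl = Equivalence.to (∈ws w) w∈ws in (Pw , Qw) , sl)
    (λ { ((Pw , Qw) , sl) → ∈-filter⁺ Q? (Equivalence.from (∈ws w) (Pw , sl)) Qw })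

Count-unique : ∀ {P P′ : List Step → Set} {n c c′} → Count P n c → Count P′ n c′ →
  (∀ {w} → P w → P′ w) → (∀ {w} → P′ w → P w) → c ≡ c′
Count-unique (ws , ws! , ∈ws , refl) (ws′ , ws′! , ∈ws′ , refl) P⇒P′ P′⇒P = length-≡-unique ws! ws′!
  (λ {w} w∈ → let Pw , sl = Equivalence.to (∈ws w) w∈ in Equivalence.from (∈ws′ w) (P⇒P′ Pw , sl))
  (λ {w} w∈ → let Pw , sl = Equivalence.to (∈ws′ w) w∈ in Equivalence.from (∈ws w) (P′⇒P Pw , sl))

module _ {P : List Step → Set} {n c} (C : Count P n c) where

  Count-Unique : Unique (proj₁ C)
  Count-Unique = proj₁ (proj₂ C)

  Count-∈⁺ : ∀ {w} → P w → semilength w ≡ n → w ∈ proj₁ C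
  Count-∈⁺ Pw sl = Equivalence.from (proj₁ (proj₂ (proj₂ C)) _) (Pw , sl)

  Count-∈⁻ : ∀ {w} → w ∈ proj₁ C → P w × semilength w ≡ n
  Count-∈⁻ w∈ = Equivalence.to (proj₁ (proj₂ (proj₂ C)) _) w∈

-- Counting paths by the height of their highest occurrence

module Levels (π : List Step) (π≢[] : π ≢ []) {a : ℕ → ℕ} (countA : ∀ n → Count (InA π) n (a n)) where

  open Occurrences π π≢[]

  AtLevel Below : ℕ → List Step → Set
  AtLevel j P = h π P ≡ r + + j
  Below j P = h π P < r + + j

  level below : ℕ → ℕ → ℕ
  level j n = length (filter (λ P → h π P ℤ.≟ r + + j) (proj₁ (countA n)))
  below j n = length (filter (λ P → h π P ℤ.<? r + + j) (proj₁ (countA n)))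

  countAtLevel : ∀ j n → Count (λ P → InA π P × AtLevel j P) n (level j n)
  countAtLevel j n = Count-filter (λ P → h π P ℤ.≟ r + + j) (countA n)

  countBelow : ∀ j n → Count (λ P → InA π P × Below j P) n (below j n)
  countBelow j n = Count-filter (λ P → h π P ℤ.<? r + + j) (countA n)

  private
    r+1+j≡suc : ∀ j → r + + suc j ≡ (r + + j) + 1ℤ
    r+1+j≡suc j = solve 2 (λ r j → r :+ (con 1ℤ :+ j) := (r :+ j) :+ con 1ℤ) refl r (+ j)
      where open +-*-Solver

    pred-r+1+j : ∀ j → ℤ.pred (r + + suc j) ≡ r + + j
    pred-r+1+j j = solve 2 (λ r j → con (- 1ℤ) :+ (r :+ (con 1ℤ :+ j)) := r :+ j) refl r (+ j)
      where open +-*-Solver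

    AtLevel⇒0< : ∀ {j} P → AtLevel j P → 0ℤ < h π P
    AtLevel⇒0< {j} _ e = ℤP.<-≤-trans (+<+ (s≤s z≤n))
      (ℤP.≤-trans (1≤amplitude π π≢[]) (ℤP.≤-trans (ℤP.i≤i+j r (+ j)) (ℤP.≤-reflexive (sym e))))

    r<r+1+j : ∀ j → r < r + + suc j
    r<r+1+j j = ℤP.≤-<-trans (ℤP.≤-reflexive (sym (ℤP.+-identityʳ r))) (ℤP.+-monoʳ-< r (+<+ (s≤s z≤n)))

    AtLevel-suc⇒≰r : ∀ {j} P → AtLevel (suc j) P → ¬ (h π P ≤ r)
    AtLevel-suc⇒≰r {j} _ e h≤r = ℤP.<⇒≱ (r<r+1+j j) (ℤP.≤-trans (ℤP.≤-reflexive (sym e)) h≤r)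

    +1≡r+1+j⇒≡r+j : ∀ {x} j → x + 1ℤ ≡ r + + suc j → x ≡ r + + j
    +1≡r+1+j⇒≡r+j {x} j e = begin
      x                  ≡⟨ solve 1 (λ x → x := x :+ con 1ℤ :- con 1ℤ) refl x ⟩
      x + 1ℤ - 1ℤ        ≡⟨ cong (_- 1ℤ) (trans e (r+1+j≡suc j)) ⟩
      r + + j + 1ℤ - 1ℤ  ≡⟨ solve 1 (λ y → y :+ con 1ℤ :- con 1ℤ := y) refl (r + + j) ⟩
      r + + j            ∎
      where
      open ≡-Reasoning
      open +-*-Solver

    <-r+1+j⇔≤ : ∀ {x} j → x < r + + suc j ⇔ x ≤ r + + j
    <-r+1+j⇔≤ {x} j = mk⇔
      (λ x< → subst (x ≤_) (pred-r+1+j j) (ℤP.i<j⇒i≤pred[j] x<))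
      (λ x≤ → ℤP.i≤pred[j]⇒i<j (subst (x ≤_) (sym (pred-r+1+j j)) x≤))

  udPath : List Step → List Step → List Step
  udPath α β = U ∷ α ++ D ∷ β

  ulPath : List Step → List Step
  ulPath α = U ∷ α ++ L ∷ []

  private
    prime : List Step → List Step
    prime α = U ∷ α ++ D ∷ []

    udPath≡prime++ : ∀ α β → udPath α β ≡ prime α ++ β
    udPath≡prime++ α β = cong (U ∷_) (sym (ListP.++-assoc α (D ∷ []) β))

    prime-Excursion : ∀ {α} → InA π α → Excursion (prime α)
    prime-Excursion α∈A = Excursion-elevate (InA⇒Excursion α∈A) refl (ℤP.≤-refl , refl)

    h[]≡0 : h π [] ≡ 0ℤ
    h[]≡0 = hAux-[] 0ℤ

  udPath-AtLevel : ∀ j {α β} → InA π α → InA π β → AtLevel j α → Below (2 ℕ.+ j) β →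
    InA π (udPath α β) × AtLevel (suc j) (udPath α β)
  udPath-AtLevel j {α} {β} α∈A β∈A α-at-j β-below = ud α∈A β∈A β≤prime , (begin
    h π (udPath α β)          ≡⟨ cong (h π) (udPath≡prime++ α β) ⟩
    h π (prime α ++ β)     ≡⟨ h-++-pos (prime-Excursion α∈A) β≤prime (AtLevel⇒0< (prime α) prime-at-1+j) ⟩
    h π (prime α)          ≡⟨ prime-at-1+j ⟩
    r + + suc j            ∎)
    where
    open ≡-Reasoning
    prime-at-1+j : AtLevel (suc j) (prime α)
    prime-at-1+j = trans (h-elevate-pos (InA⇒Excursion α∈A) refl (AtLevel⇒0< α α-at-j))
      (trans (cong (_+ 1ℤ) α-at-j) (sym (r+1+j≡suc j)))
    β≤prime : h π β ≤ h π (prime α)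
    β≤prime = ℤP.≤-trans (Equivalence.to (<-r+1+j⇔≤ (suc j)) β-below) (ℤP.≤-reflexive (sym prime-at-1+j))

  ulPath-AtLevel : ∀ j {α} → InA π α → AtLevel j α → InA π (ulPath α) × AtLevel (suc j) (ulPath α)
  ulPath-AtLevel j {α} α∈A α-at-j = ul α∈A α≢[] ,
    trans (h-elevate-pos (InA⇒Excursion α∈A) refl 0<hα) (trans (cong (_+ 1ℤ) α-at-j) (sym (r+1+j≡suc j)))
    where
    0<hα = AtLevel⇒0< α α-at-j
    α≢[] : α ≢ []
    α≢[] refl = ℤP.<-irrefl (sym h[]≡0) 0<hα

  private
    0<h-unless-0 : ∀ P → (h π P ≡ 0ℤ → ⊥) → 0ℤ < h π P
    0<h-unless-0 P h≢0 = ℤP.≤∧≢⇒< (hAux-nonneg 0ℤ P) (λ 0≡h → h≢0 (sym 0≡h))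

    elevated-AtLevel : ∀ j {α s} → InA π α → dy s ≡ - 1ℤ → AtLevel (suc j) (U ∷ α ++ s ∷ []) → AtLevel j α
    elevated-AtLevel j {α} {s} α∈A s-down e = +1≡r+1+j⇒≡r+j j
      (trans (sym (h-elevate-pos exα s-down 0<hα)) e)
      where
      exα = InA⇒Excursion α∈A
      0<hα = 0<h-unless-0 α (λ h≡0 → AtLevel-suc⇒≰r (U ∷ α ++ s ∷ []) e (h-elevate-zero exα s-down h≡0))

  AtLevel-suc-decomposition : ∀ j {P} → InA π P → AtLevel (suc j) P →
    (∃ λ α → ∃ λ β → P ≡ udPath α β × (InA π α × AtLevel j α) × (InA π β × Below (2 ℕ.+ j) β))
    ⊎ (∃ λ α → P ≡ ulPath α × (InA π α × AtLevel j α))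
  AtLevel-suc-decomposition j nil e = ⊥-elim (AtLevel-suc⇒≰r [] e (ℤP.≤-trans (ℤP.≤-reflexive h[]≡0) (0≤amplitude π)))
  AtLevel-suc-decomposition j (ul {α} α∈A _) e = inj₂ (α , refl , α∈A , elevated-AtLevel j α∈A refl e)
  AtLevel-suc-decomposition j (ud {α} {β} α∈A β∈A β≤prime) e =
    inj₁ (α , β , refl , (α∈A , elevated-AtLevel j α∈A refl prime-at-1+j) , (β∈A , β-below))
    where
    ex-prime = prime-Excursion α∈A
    0<h-prime : 0ℤ < h π (prime α)
    0<h-prime = 0<h-unless-0 (prime α) (λ h≡0 →
      AtLevel-suc⇒≰r (prime α ++ β) (trans (cong (h π) (sym (udPath≡prime++ α β))) e) (h-++-zero ex-prime β≤prime h≡0))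
    prime-at-1+j : AtLevel (suc j) (prime α)
    prime-at-1+j = trans (sym (trans (cong (h π) (udPath≡prime++ α β)) (h-++-pos ex-prime β≤prime 0<h-prime))) e
    β-below : Below (2 ℕ.+ j) β
    β-below = Equivalence.from (<-r+1+j⇔≤ (suc j)) (ℤP.≤-trans β≤prime (ℤP.≤-reflexive prime-at-1+j))

  private
    first-return-InA : ∀ {α α′ s s′ β β′} → InA π α → InA π α′ → dy s ≡ - 1ℤ → dy s′ ≡ - 1ℤ →
      U ∷ α ++ s ∷ β ≡ U ∷ α′ ++ s′ ∷ β′ → α ≡ α′ × s ≡ s′ × β ≡ β′
    first-return-InA α∈A α′∈A s-down s′-down e =
      first-return-unique nn nn′ (trans (ℤP.+-identityˡ _) ord) (trans (ℤP.+-identityˡ _) ord′) s-down s′-down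
        (proj₂ (ListP.∷-injective e))
      where
      nn = proj₁ (InA⇒Excursion α∈A)
      ord = proj₂ (InA⇒Excursion α∈A)
      nn′ = proj₁ (InA⇒Excursion α′∈A)
      ord′ = proj₂ (InA⇒Excursion α′∈A)

  udPath-injective : ∀ {α α′ β β′} → InA π α → InA π α′ → udPath α β ≡ udPath α′ β′ → α ≡ α′ × β ≡ β′
  udPath-injective α∈A α′∈A e with first-return-InA α∈A α′∈A refl refl e
  ... | refl , _ , refl = refl , refl

  ulPath-injective : ∀ {α α′} → InA π α → InA π α′ → ulPath α ≡ ulPath α′ → α ≡ α′
  ulPath-injective α∈A α′∈A e = proj₁ (first-return-InA α∈A α′∈A refl refl e)

  udPath≢ulPath : ∀ {α α′ β} → InA π α → InA π α′ → udPath α β ≢ ulPath α′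
  udPath≢ulPath α∈A α′∈A e with first-return-InA α∈A α′∈A refl refl e
  ... | _ , () , _

  private
    semilength-udPath : ∀ α β → semilength (udPath α β) ≡ suc (semilength α ℕ.+ semilength β)
    semilength-udPath α β = cong suc (semilength-++ α (D ∷ β))

    semilength-ulPath : ∀ α → semilength (ulPath α) ≡ suc (semilength α ℕ.+ 0)
    semilength-ulPath α = cong suc (semilength-++ α (L ∷ []))

  module _ (j n : ℕ) where

    private
      atLevel : ℕ → List (List Step)
      atLevel i = proj₁ (countAtLevel j i)

      block : ℕ → List (List Step)
      block i = cartesianProductWith udPath (atLevel i) (proj₁ (countBelow (2 ℕ.+ j) (n ∸ i)))

      decomposed : List (List Step)
      decomposed = unionUpTo block n ++ map ulPath (atLevel n)

      ∈block⁻ : ∀ {i P} → P ∈ block i → ∃ λ α → ∃ λ β →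
        ((InA π α × AtLevel j α) × semilength α ≡ i) × ((InA π β × Below (2 ℕ.+ j) β) × semilength β ≡ n ∸ i) × P ≡ udPath α β
      ∈block⁻ {i} P∈ with ∈-cartesianProductWith⁻ udPath (atLevel i) _ P∈
      ... | α , β , α∈ , β∈ , refl = α , β , Count-∈⁻ (countAtLevel j i) α∈ , Count-∈⁻ (countBelow (2 ℕ.+ j) (n ∸ i)) β∈ , refl

      block-Unique : ∀ i → Unique (block i)
      block-Unique i = Unique-cartesianProductWith⁺-on udPath
        (λ α∈ α′∈ _ _ → udPath-injective (proj₁ (proj₁ (Count-∈⁻ (countAtLevel j i) α∈)))
                                      (proj₁ (proj₁ (Count-∈⁻ (countAtLevel j i) α′∈))))
        (Count-Unique (countAtLevel j i)) (Count-Unique (countBelow (2 ℕ.+ j) (n ∸ i)))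

      blocks-disjoint : ∀ {i i′ P} → P ∈ block i → P ∈ block i′ → i ≡ i′
      blocks-disjoint P∈ P∈′ with ∈block⁻ P∈ | ∈block⁻ P∈′
      ... | α , _ , ((α∈A , _) , sl) , _ , refl | α′ , _ , ((α′∈A , _) , sl′) , _ , e
        with udPath-injective α∈A α′∈A e
      ...   | refl , refl = trans (sym sl) sl′

      decomposed-Unique : Unique decomposed
      decomposed-Unique = UniqueP.++⁺ (Unique-unionUpTo block n block-Unique blocks-disjoint)
        (Unique-map⁺-on ulPath (λ α∈ α′∈ → ulPath-injective (proj₁ (proj₁ (Count-∈⁻ (countAtLevel j n) α∈)))
                                                       (proj₁ (proj₁ (Count-∈⁻ (countAtLevel j n) α′∈))))
                        (Count-Unique (countAtLevel j n)))
        D-or-L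
        where
        D-or-L : Disjoint (unionUpTo block n) (map ulPath (atLevel n))
        D-or-L (P∈D , P∈L) with ∈-unionUpTo⁻ block n P∈D | ∈-map⁻ ulPath P∈L
        ... | _ , _ , P∈block | α′ , α′∈ , refl with ∈block⁻ P∈block
        ...   | α , _ , ((α∈A , _) , _) , _ , e =
          udPath≢ulPath α∈A (proj₁ (proj₁ (Count-∈⁻ (countAtLevel j n) α′∈))) (sym e)

      decomposed⊆ : ∀ {P} → P ∈ decomposed → P ∈ proj₁ (countAtLevel (suc j) (suc n))
      decomposed⊆ P∈ with ∈-++⁻ (unionUpTo block n) P∈
      ... | inj₁ P∈D with ∈-unionUpTo⁻ block n P∈D
      ...   | i , i≤n , P∈block with ∈block⁻ P∈block
      ...     | α , β , ((α∈A , α-at-j) , slα) , ((β∈A , β-below) , slβ) , refl =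
        Count-∈⁺ (countAtLevel (suc j) (suc n)) (udPath-AtLevel j α∈A β∈A α-at-j β-below)
          (trans (semilength-udPath α β) (cong suc (trans (cong₂ ℕ._+_ slα slβ) (ℕP.m+[n∸m]≡n i≤n))))
      decomposed⊆ P∈ | inj₂ P∈L with ∈-map⁻ ulPath P∈L
      ... | α , α∈ , refl with Count-∈⁻ (countAtLevel j n) α∈
      ...   | (α∈A , α-at-j) , slα =
        Count-∈⁺ (countAtLevel (suc j) (suc n)) (ulPath-AtLevel j α∈A α-at-j)
          (trans (semilength-ulPath α) (cong suc (trans (ℕP.+-identityʳ _) slα)))

      ⊆decomposed : ∀ {P} → P ∈ proj₁ (countAtLevel (suc j) (suc n)) → P ∈ decomposed
      ⊆decomposed P∈ with Count-∈⁻ (countAtLevel (suc j) (suc n)) P∈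
      ... | (P∈A , P-at-1+j) , slP with AtLevel-suc-decomposition j P∈A P-at-1+j
      ...   | inj₁ (α , β , refl , α-at-j , β-below) =
        ∈-++⁺ˡ (∈-unionUpTo⁺ block i≤n (∈-cartesianProductWith⁺ udPath
          (Count-∈⁺ (countAtLevel j _) α-at-j refl) (Count-∈⁺ (countBelow (2 ℕ.+ j) _) β-below slβ)))
        where
        sl+sl≡n : semilength α ℕ.+ semilength β ≡ n
        sl+sl≡n = ℕP.suc-injective (trans (sym (semilength-udPath α β)) slP)
        i≤n : semilength α ℕ.≤ n
        i≤n = subst (semilength α ℕ.≤_) sl+sl≡n (ℕP.m≤m+n _ _)
        slβ : semilength β ≡ n ∸ semilength α
        slβ = trans (sym (ℕP.m+n∸m≡n (semilength α) (semilength β))) (cong (_∸ semilength α) sl+sl≡n)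
      ...   | inj₂ (α , refl , α-at-j) =
        ∈-++⁺ʳ (unionUpTo block n) (∈-map⁺ ulPath (Count-∈⁺ (countAtLevel j n) α-at-j
          (trans (sym (ℕP.+-identityʳ _)) (ℕP.suc-injective (trans (sym (semilength-ulPath α)) slP)))))

    level-suc-suc : + level (suc j) (suc n) ≡ sumTo (λ i → + level j i * + below (2 ℕ.+ j) (n ∸ i)) n + + level j n
    level-suc-suc = begin
      + level (suc j) (suc n)                                         ≡⟨ cong +_ (length-≡-unique (Count-Unique (countAtLevel (suc j) (suc n)))
                                                                            decomposed-Unique ⊆decomposed decomposed⊆) ⟩
      + length decomposed                                             ≡⟨ cong +_ (ListP.length-++ (unionUpTo block n)) ⟩
      + (length (unionUpTo block n) ℕ.+ length (map ulPath (atLevel n)))  ≡⟨ ℤP.pos-+ (length (unionUpTo block n)) _ ⟩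
      + length (unionUpTo block n) + + length (map ulPath (atLevel n))    ≡⟨ cong₂ _+_ (length-unionUpTo block n) (cong +_ (ListP.length-map ulPath (atLevel n))) ⟩
      sumTo (λ i → + length (block i)) n + + level j n                 ≡⟨ cong (_+ + level j n) (sumTo-cong block-length n) ⟩
      sumTo (λ i → + level j i * + below (2 ℕ.+ j) (n ∸ i)) n + + level j n ∎
      where
      open ≡-Reasoning
      block-length : ∀ i → + length (block i) ≡ + level j i * + below (2 ℕ.+ j) (n ∸ i)
      block-length i = trans (cong +_ (length-cartesianProductWith udPath (atLevel i) _)) (ℤP.pos-* (level j i) (below (2 ℕ.+ j) (n ∸ i)))

  private
    paths : ℕ → List (List Step)
    paths n = proj₁ (countA n)

    InA-semilength-0 : ∀ {P} → InA π P → semilength P ≡ 0 → P ≡ []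
    InA-semilength-0 nil _ = refl
    InA-semilength-0 (ud {α} {β} _ _ _) sl with trans (sym (semilength-udPath α β)) sl
    ... | ()
    InA-semilength-0 (ul {α} _ _) sl with trans (sym (semilength-ulPath α)) sl
    ... | ()

  level-suc-zero : ∀ j → level (suc j) 0 ≡ 0
  level-suc-zero j = cong length (ListP.filter-none (λ P → h π P ℤ.≟ r + + suc j) (All.tabulate not-at-level))
    where
    not-at-level : ∀ {P} → P ∈ paths 0 → ¬ AtLevel (suc j) P
    not-at-level P∈ e with Count-∈⁻ (countA 0) P∈
    ... | P∈A , sl with InA-semilength-0 P∈A sl
    ...   | refl = AtLevel-suc⇒≰r [] e (ℤP.≤-trans (ℤP.≤-reflexive h[]≡0) (0≤amplitude π))

  below-suc : ∀ j n → below (suc j) n ≡ below j n ℕ.+ level j n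
  below-suc j n = length-filter-⊎ (λ P → h π P ℤ.<? r + + suc j) (λ P → h π P ℤ.<? r + + j)
    (λ P → h π P ℤ.≟ r + + j) (paths n) (λ P _ → split P) (λ P _ → merge P) exclusive
    where
    split : ∀ P → Below (suc j) P → Below j P ⊎ AtLevel j P
    split P below with h π P ℤ.≟ r + + j
    ... | yes e = inj₂ e
    ... | no ≢ = inj₁ (ℤP.≤∧≢⇒< (Equivalence.to (<-r+1+j⇔≤ j) below) ≢)
    merge : ∀ P → Below j P ⊎ AtLevel j P → Below (suc j) P
    merge P (inj₁ below) = ℤP.<-trans below (ℤP.+-monoʳ-< r (+<+ (ℕP.n<1+n j)))
    merge P (inj₂ e) = Equivalence.from (<-r+1+j⇔≤ j) (ℤP.≤-reflexive e)
    exclusive : ∀ P → Below j P → AtLevel j P → ⊥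
    exclusive P below e = ℤP.<⇒≢ below e

  below-saturated : ∀ {j n} → 2 ℕ.* n ℕ.≤ j → below j n ≡ a n
  below-saturated {j} {n} 2n≤j = trans
    (cong length (ListP.filter-all (λ P → h π P ℤ.<? r + + j) (All.tabulate low)))
    (proj₂ (proj₂ (proj₂ (countA n))))
    where
    low : ∀ {P} → P ∈ paths n → Below j P
    low {P} P∈ with Count-∈⁻ (countA n) P∈
    ... | P∈A , refl = ℤP.≤-<-trans (h≤2*semilength π π≢[] (InA⇒Excursion P∈A))
      (ℤP.≤-<-trans (+≤+ 2n≤j) (ℤP.≤-<-trans (ℤP.≤-reflexive (sym (ℤP.+-identityˡ (+ j))))
        (ℤP.+-monoˡ-< (+ j) (ℤP.<-≤-trans (+<+ (s≤s z≤n)) (1≤amplitude π π≢[])))))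

  level-zero : ∀ {u : ℕ → ℕ} → (∀ n → Count (λ P → InA π P × h π P ≡ amplitude π) n (u n)) → ∀ n → level 0 n ≡ u n
  level-zero countU n = Count-unique (countAtLevel 0 n) (countU n)
    (λ (P∈A , e) → P∈A , trans e (ℤP.+-identityʳ r))
    (λ (P∈A , e) → P∈A , trans e (sym (ℤP.+-identityʳ r)))

  below-zero : ∀ {v : ℕ → ℕ} → (∀ n → Count (λ P → InA π P × h π P ≡ + 0) n (v n)) → ∀ n → below 0 n ≡ v n
  below-zero countV n = Count-unique (countBelow 0 n) (countV n) below⇒0 0⇒below
    where
    below⇒0 : ∀ {P} → InA π P × Below 0 P → InA π P × h π P ≡ 0ℤ
    below⇒0 {P} (P∈A , below) with h-gap (InA⇒Excursion P∈A)
    ... | inj₁ h≡0 = P∈A , h≡0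
    ... | inj₂ r≤h = ⊥-elim (ℤP.<⇒≱ below (ℤP.≤-trans (ℤP.≤-reflexive (ℤP.+-identityʳ r)) r≤h))
    0⇒below : ∀ {P} → InA π P × h π P ≡ 0ℤ → InA π P × Below 0 P
    0⇒below {P} (P∈A , h≡0) = P∈A , ℤP.<-≤-trans (subst (_< 1ℤ) (sym h≡0) (+<+ (s≤s z≤n)))
      (ℤP.≤-trans (1≤amplitude π π≢[]) (ℤP.≤-reflexive (sym (ℤP.+-identityʳ r))))

-- The generating functions

module GeneratingFunctions (π : List Step) (π≢[] : π ≢ []) {a u v : ℕ → ℕ}
  (countA : ∀ n → Count (InA π) n (a n))
  (countU : ∀ n → Count (λ P → InA π P × h π P ≡ amplitude π) n (u n))
  (countV : ∀ n → Count (λ P → InA π P × h π P ≡ + 0) n (v n)) where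

  open Levels π π≢[] countA

  c : ℕ → Series
  c j = 1ₛ ⊕ toS (below j)

  private
    levels : ℕ → Series
    levels j = toS (level j)

    c-suc : ∀ j → c (suc j) ⊖ c j ≈ levels j
    c-suc j n rewrite below-suc j n =
      solve 3 (λ o x y → (o :+ (x :+ y)) :- (o :+ x) := y) refl (1ₛ n) (+ below j n) (+ level j n)
      where open +-*-Solver

    levels-suc : ∀ j → levels (suc j) ≈ X ⊛ (levels j ⊛ c (2 ℕ.+ j))
    levels-suc j zero = cong +_ (level-suc-zero j)
    levels-suc j (suc n) = begin
      + level (suc j) (suc n)                                          ≡⟨ level-suc-suc j n ⟩
      (levels j ⊛ below₂) n + levels j n               ≡⟨ cong (λ z → (levels j ⊛ below₂) n + z) (sym (⊛-identityʳ (levels j) n)) ⟩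
      (levels j ⊛ below₂) n + (levels j ⊛ 1ₛ) n        ≡⟨ ℤP.+-comm ((levels j ⊛ below₂) n) _ ⟩
      (levels j ⊛ 1ₛ) n + (levels j ⊛ below₂) n        ≡⟨ sym (⊛-distribˡ-⊕ (levels j) 1ₛ below₂ n) ⟩
      (levels j ⊛ c (2 ℕ.+ j)) n                                      ≡⟨ sym (X⊛-suc (levels j ⊛ c (2 ℕ.+ j)) n) ⟩
      (X ⊛ (levels j ⊛ c (2 ℕ.+ j))) (suc n)                          ∎
      where
      open ≡-Reasoning
      below₂ = toS (below (2 ℕ.+ j))

  c-recurrence : ∀ j → recurrence (c j) (c (suc j)) (c (2 ℕ.+ j)) ≈ 0ₛ
  c-recurrence j n = begin
    (c₂ ⊖ c₁) n - ((X ⊛ (c₁ ⊖ c₀)) ⊛ c₂) n   ≡⟨ cong₂ _-_ (c-suc (suc j) n) (⊛-cong {g = c₂} {g′ = c₂} (⊛-cong {f = X} {f′ = X} (λ _ → refl) (c-suc j)) (λ _ → refl) n) ⟩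
    levels (suc j) n - ((X ⊛ levels j) ⊛ c₂) n ≡⟨ cong₂ _-_ (levels-suc j n) (⊛-assoc X (levels j) c₂ n) ⟩
    (X ⊛ (levels j ⊛ c₂)) n - (X ⊛ (levels j ⊛ c₂)) n ≡⟨ ℤP.+-inverseʳ ((X ⊛ (levels j ⊛ c₂)) n) ⟩
    0ℤ                                        ∎
    where
    open ≡-Reasoning
    c₀ = c j
    c₁ = c (suc j)
    c₂ = c (2 ℕ.+ j)

  c-converges : Converges c (1ₛ ⊕ toS a)
  c-converges n = 2 ℕ.* n , λ j 2n≤j m m≤n →
    cong (λ k → 1ₛ m + + k) (below-saturated (ℕP.≤-trans (ℕP.*-monoʳ-≤ 2 m≤n) 2n≤j))

  generating-function-quadratic : quadratic (1ₛ ⊕ toS v) (1ₛ ⊕ toS v ⊕ toS u) (toS a) ≈ 0ₛ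
  generating-function-quadratic = λ n → trans (quadratic-cong (toS a) c₀≈1+V c₁≈1+V+U n)
    (quadratic-limit c (toS a) (λ j ()) c-recurrence c-converges n)
    where
    c₀≈1+V : 1ₛ ⊕ toS v ≈ c 0
    c₀≈1+V n = cong (λ k → 1ₛ n + + k) (sym (below-zero countV n))
    c₁≈1+V+U : 1ₛ ⊕ toS v ⊕ toS u ≈ c 1
    c₁≈1+V+U n = begin
      1ₛ n + + v n + + u n              ≡⟨ ℤP.+-assoc (1ₛ n) _ _ ⟩
      1ₛ n + (+ v n + + u n)            ≡⟨ cong (λ z → 1ₛ n + z) (sym (ℤP.pos-+ (v n) (u n))) ⟩
      1ₛ n + + (v n ℕ.+ u n)            ≡⟨ cong (λ k → 1ₛ n + + k) (sym (trans (below-suc 0 n)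
                                             (cong₂ ℕ._+_ (below-zero countV n) (level-zero countU n)))) ⟩
      c 1 n                             ∎
      where open ≡-Reasoning

-- The closed form, as expressions in the variables U, V, x, A

‵U ‵V ‵x ‵A : Expr 4
‵U = ‵var zero
‵V = ‵var (suc zero)
‵x = ‵var (suc (suc zero))
‵A = ‵var (suc (suc (suc zero)))

numeratorₑ discriminantₑ rootₑ : Expr 4
numeratorₑ = ‵U ‵⊛ ‵V ‵⊛ ‵x ‵^ 2 ‵⊕ ‵V ‵^ 2 ‵⊛ ‵x ‵^ 2 ‵⊖ ‵x ‵^ 2 ‵⊛ ‵U ‵⊖ ‵x ‵⊛ ‵U ‵⊖ ‵x ‵^ 2 ‵⊕ ‵cst 1ℤ
discriminantₑ =
  ‵U ‵^ 2 ‵⊛ ‵V ‵^ 2 ‵⊛ ‵x ‵^ 4 ‵⊕ (+ 2) ‵· ‵U ‵⊛ ‵V ‵^ 3 ‵⊛ ‵x ‵^ 4 ‵⊕ ‵V ‵^ 4 ‵⊛ ‵x ‵^ 4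
  ‵⊕ (+ 2) ‵· ‵U ‵^ 2 ‵⊛ ‵V ‵⊛ ‵x ‵^ 4 ‵⊕ (+ 6) ‵· ‵U ‵⊛ ‵V ‵^ 2 ‵⊛ ‵x ‵^ 4 ‵⊕ (+ 4) ‵· ‵V ‵^ 3 ‵⊛ ‵x ‵^ 4
  ‵⊖ (+ 2) ‵· ‵U ‵^ 2 ‵⊛ ‵V ‵⊛ ‵x ‵^ 3 ‵⊕ ‵U ‵^ 2 ‵⊛ ‵x ‵^ 4 ‵⊖ (+ 2) ‵· ‵U ‵⊛ ‵V ‵^ 2 ‵⊛ ‵x ‵^ 3
  ‵⊕ (+ 6) ‵· ‵U ‵⊛ ‵V ‵⊛ ‵x ‵^ 4 ‵⊕ (+ 6) ‵· ‵V ‵^ 2 ‵⊛ ‵x ‵^ 4 ‵⊖ (+ 2) ‵· ‵x ‵^ 3 ‵⊛ ‵U ‵^ 2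
  ‵⊖ (+ 4) ‵· ‵U ‵⊛ ‵V ‵⊛ ‵x ‵^ 3 ‵⊕ (+ 2) ‵· ‵U ‵⊛ ‵x ‵^ 4 ‵⊕ (+ 4) ‵· ‵V ‵⊛ ‵x ‵^ 4
  ‵⊖ (+ 3) ‵· ‵U ‵^ 2 ‵⊛ ‵x ‵^ 2 ‵⊖ (+ 6) ‵· ‵U ‵⊛ ‵V ‵⊛ ‵x ‵^ 2 ‵⊖ (+ 2) ‵· ‵U ‵⊛ ‵x ‵^ 3
  ‵⊖ (+ 2) ‵· ‵V ‵^ 2 ‵⊛ ‵x ‵^ 2 ‵⊕ ‵x ‵^ 4 ‵⊖ (+ 6) ‵· ‵x ‵^ 2 ‵⊛ ‵U ‵⊖ (+ 4) ‵· ‵V ‵⊛ ‵x ‵^ 2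
  ‵⊖ (+ 2) ‵· ‵x ‵⊛ ‵U ‵⊖ (+ 2) ‵· ‵x ‵^ 2 ‵⊕ ‵cst 1ℤ
-- N - 2x²(1+V+U)A, which is √Δ when A is the generating function
rootₑ = numeratorₑ ‵⊖ (+ 2) ‵· ‵x ‵^ 2 ‵⊛ (‵cst 1ℤ ‵⊕ ‵V ‵⊕ ‵U) ‵⊛ ‵A

module _ (U V A : Series) where

  open SeriesSolver

  private
    ρ : Vec Series 4
    ρ = U ∷ V ∷ X ∷ A ∷ []
    u v x a : Polynomial 4
    u = var zero
    v = var (suc zero)
    x = var (suc (suc zero))
    a = var (suc (suc (suc zero)))

  root-constant-term : ⟦ rootₑ ⟧ₑ ρ 0 ≡ 1ℤ
  root-constant-term = trans (⟦⟧ₑ≈⟦toPolynomial⟧ rootₑ ρ 0) (prove ρ (toPolynomial rootₑ) (con 1ℤ :+ x :* q) (λ _ → refl) 0)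
    where
    q : Polynomial 4
    q = u :* v :* x :+ (v :^ 2) :* x :- x :* u :- u :- x :- con (+ 2) :* x :* (con 1ℤ :+ u :+ v) :* a

  root-squared : quadratic (1ₛ ⊕ V) (1ₛ ⊕ V ⊕ U) A ≈ 0ₛ → ⟦ rootₑ ⟧ₑ ρ ⊛ ⟦ rootₑ ⟧ₑ ρ ≈ ⟦ discriminantₑ ⟧ₑ ρ
  root-squared A-quadratic n = begin
    (⟦ rootₑ ⟧ₑ ρ ⊛ ⟦ rootₑ ⟧ₑ ρ) n               ≡⟨ ⊛-cong (⟦⟧ₑ≈⟦toPolynomial⟧ rootₑ ρ) (⟦⟧ₑ≈⟦toPolynomial⟧ rootₑ ρ) n ⟩
    ⟦ toPolynomial rootₑ :* toPolynomial rootₑ ⟧ ρ n ≡⟨ prove ρ (toPolynomial rootₑ :* toPolynomial rootₑ)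
                                                          (toPolynomial discriminantₑ :+ K :* quadraticₚ (con 1ℤ :+ v) (con 1ℤ :+ v :+ u) x a)
                                                          (λ _ → refl) n ⟩
    ⟦ toPolynomial discriminantₑ ⟧ ρ n + (⟦ K ⟧ ρ ⊛ quadratic (1ₛ ⊕ V) (1ₛ ⊕ V ⊕ U) A) n
                                                    ≡⟨ cong (λ z → ⟦ toPolynomial discriminantₑ ⟧ ρ n + z)
                                                         (trans (⊛-cong {f = ⟦ K ⟧ ρ} {f′ = ⟦ K ⟧ ρ} (λ _ → refl) A-quadratic n) (⊛-zeroʳ (⟦ K ⟧ ρ) n)) ⟩
    ⟦ toPolynomial discriminantₑ ⟧ ρ n + 0ℤ       ≡⟨ ℤP.+-identityʳ _ ⟩
    ⟦ toPolynomial discriminantₑ ⟧ ρ n            ≡⟨ sym (⟦⟧ₑ≈⟦toPolynomial⟧ discriminantₑ ρ n) ⟩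
    ⟦ discriminantₑ ⟧ₑ ρ n                         ∎
    where
    open ≡-Reasoning
    K : Polynomial 4
    K = con (+ 4) :* (x :^ 2) :* (con 1ℤ :+ u :+ v)

corollary2 : (π : List Step) → π ≢ [] →
  (a u v : ℕ → ℕ) →
  (∀ n → Count (InA π) n (a n)) →
  (∀ n → Count (λ P → InA π P × h π P ≡ amplitude π) n (u n)) →
  (∀ n → Count (λ P → InA π P × h π P ≡ + 0) n (v n)) →
  let A = toS a
      U' = toS u
      V = toS v
      x = X
      N = U' ⊛ V ⊛ x ^ₛ 2 ⊕ V ^ₛ 2 ⊛ x ^ₛ 2 ⊖ x ^ₛ 2 ⊛ U' ⊖ x ⊛ U' ⊖ x ^ₛ 2 ⊕ cst 1ℤ
      Δ = U' ^ₛ 2 ⊛ V ^ₛ 2 ⊛ x ^ₛ 4 ⊕ (+ 2) · U' ⊛ V ^ₛ 3 ⊛ x ^ₛ 4 ⊕ V ^ₛ 4 ⊛ x ^ₛ 4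
          ⊕ (+ 2) · U' ^ₛ 2 ⊛ V ⊛ x ^ₛ 4 ⊕ (+ 6) · U' ⊛ V ^ₛ 2 ⊛ x ^ₛ 4 ⊕ (+ 4) · V ^ₛ 3 ⊛ x ^ₛ 4
          ⊖ (+ 2) · U' ^ₛ 2 ⊛ V ⊛ x ^ₛ 3 ⊕ U' ^ₛ 2 ⊛ x ^ₛ 4 ⊖ (+ 2) · U' ⊛ V ^ₛ 2 ⊛ x ^ₛ 3
          ⊕ (+ 6) · U' ⊛ V ⊛ x ^ₛ 4 ⊕ (+ 6) · V ^ₛ 2 ⊛ x ^ₛ 4 ⊖ (+ 2) · x ^ₛ 3 ⊛ U' ^ₛ 2
          ⊖ (+ 4) · U' ⊛ V ⊛ x ^ₛ 3 ⊕ (+ 2) · U' ⊛ x ^ₛ 4 ⊕ (+ 4) · V ⊛ x ^ₛ 4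
          ⊖ (+ 3) · U' ^ₛ 2 ⊛ x ^ₛ 2 ⊖ (+ 6) · U' ⊛ V ⊛ x ^ₛ 2 ⊖ (+ 2) · U' ⊛ x ^ₛ 3
          ⊖ (+ 2) · V ^ₛ 2 ⊛ x ^ₛ 2 ⊕ x ^ₛ 4 ⊖ (+ 6) · x ^ₛ 2 ⊛ U' ⊖ (+ 4) · V ⊛ x ^ₛ 2
          ⊖ (+ 2) · x ⊛ U' ⊖ (+ 2) · x ^ₛ 2 ⊕ cst 1ℤ
      -- A = (N - √Δ) / (2x²(1+v+u))  ⇔  √Δ = N - 2x²(1+v+u) A
      S = N ⊖ (+ 2) · x ^ₛ 2 ⊛ (cst 1ℤ ⊕ V ⊕ U') ⊛ A
  in (S 0 ≡ 1ℤ) × (∀ n → (S ⊛ S) n ≡ Δ n)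
corollary2 π π≢[] a u v countA countU countV =
  root-constant-term (toS u) (toS v) (toS a) ,
  root-squared (toS u) (toS v) (toS a) (GeneratingFunctions.generating-function-quadratic π π≢[] countA countU countV)
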